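{- Let $n\ge 3$ be an integer and $G$ a finite simple graph, and suppose it is not the case that $G=K_2$ and $n=3$. Then $G\times K_n$ is super edge connected if and only if $n\kappa'(G)>\delta(G)$.
   Context: All graphs are finite, undirected, without loops or multiple edges. $\kappa'(X)$ denotes the edge connectivity, $\delta(X)$ the minimum degree, $K_n$ the complete graph on $n$ vertices. The direct product $G\times H$ has vertex set $V(G)\times V(H)$, with $(x,u)$ adjacent to $(y,v)$ if and only if $xy\in E(G)$ and $uv\in E(H)$. A graph is super edge connected if every minimum edge cut (edge set of minimum size whose removal disconnects the graph) is the set of all edges incident with some vertex. -}

module Defs where

open import Data.Bool using (Bool; true; false; _∧_; _∨_; not; if_then_else_)
open import Data.Nat using (ℕ; zero; suc; _+_; _*_; _≤_; _<_; _⊓_)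
open import Data.Fin using (Fin; zero; suc; toℕ; remQuot; _≟_)
open import Data.Product using (Σ; ∃; _×_; _,_; proj₁; proj₂)
open import Data.Sum using (_⊎_)
open import Relation.Nullary using (¬_)
open import Relation.Nullary.Decidable using (⌊_⌋)
open import Relation.Binary.PropositionalEquality using (_≡_)

record Graph (m : ℕ) : Set where
  field
    adj    : Fin m → Fin m → Bool
    adjSym    : ∀ x y → adj x y ≡ adj y x
    adjIrrefl : ∀ x → adj x x ≡ false
open Graph public

record Iso {a b : ℕ} (G : Graph a) (H : Graph b) : Set where
  field
    to       : Fin a → Fin b
    from     : Fin b → Fin a
    from∘to  : ∀ x → from (to x) ≡ x
    to∘from  : ∀ y → to (from y) ≡ y
    preserve : ∀ x y → adj H (to x) (to y) ≡ adj G x y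

_==_ : ∀ {m} → Fin m → Fin m → Bool
x == y = ⌊ x ≟ y ⌋

K : (n : ℕ) → Graph n
K n = record { adj = λ x y → not (x == y) ; adjSym = symK ; adjIrrefl = irrK }
  where
  open import Relation.Nullary using (yes; no)
  open import Relation.Binary.PropositionalEquality using (refl; sym)
  symK : ∀ x y → not (x == y) ≡ not (y == x)
  symK x y with x ≟ y | y ≟ x
  ... | yes _ | yes _ = refl
  ... | no _  | no _  = refl
  ... | yes p | no q  = Data.Empty.⊥-elim (q (sym p)) where import Data.Empty
  ... | no p  | yes q = Data.Empty.⊥-elim (p (sym q)) where import Data.Empty
  irrK : ∀ x → not (x == x) ≡ false
  irrK x with x ≟ x
  ... | yes _ = refl
  ... | no p  = Data.Empty.⊥-elim (p refl) where import Data.Empty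

-- Direct (tensor / categorical) product G × H on Fin (a * b), where the
-- vertex i corresponds to the pair remQuot b i = (x , u) ∈ Fin a × Fin b.
_⊗_ : ∀ {a b} → Graph a → Graph b → Graph (a * b)
_⊗_ {a} {b} G H = record { adj = A ; adjSym = symA ; adjIrrefl = irrA }
  where
  open import Relation.Binary.PropositionalEquality using (refl; cong₂)
  p₁ : Fin (a * b) → Fin a
  p₁ i = proj₁ (remQuot {a} b i)
  p₂ : Fin (a * b) → Fin b
  p₂ i = proj₂ (remQuot {a} b i)
  A : Fin (a * b) → Fin (a * b) → Bool
  A i j = adj G (p₁ i) (p₁ j) ∧ adj H (p₂ i) (p₂ j)
  symA : ∀ i j → A i j ≡ A j i
  symA i j = cong₂ _∧_ (adjSym G _ _) (adjSym H _ _)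
  irrA : ∀ i → A i i ≡ false
  irrA i with adj G (p₁ i) (p₁ i) | adjIrrefl G (p₁ i)
  ... | .false | refl = refl

sumFin : ∀ {m} → (Fin m → ℕ) → ℕ
sumFin {zero}  f = 0
sumFin {suc m} f = f zero + sumFin (λ i → f (suc i))

minFin : ∀ {m} → (Fin (suc m) → ℕ) → ℕ
minFin {zero}  f = f zero
minFin {suc m} f = f zero ⊓ minFin (λ i → f (suc i))

degree : ∀ {m} → Graph m → Fin m → ℕ
degree G x = sumFin (λ y → if adj G x y then 1 else 0)

δ : ∀ {m} → Graph (suc m) → ℕ
δ G = minFin (degree G)

record EdgeSet {m : ℕ} (G : Graph m) : Set where
  field
    mem    : Fin m → Fin m → Bool
    memSym : ∀ x y → mem x y ≡ mem y x
    sub    : ∀ x y → mem x y ≡ true → adj G x y ≡ true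
open EdgeSet public

-- Number of edges in F (each unordered edge {x,y} counted once, via x < y).
size : ∀ {m} {G : Graph m} → EdgeSet G → ℕ
size F = sumFin (λ x → sumFin (λ y →
  if mem F x y then (if ⌊ toℕ x Data.Nat.<? toℕ y ⌋ then 1 else 0) else 0))
  where import Data.Nat

data Reach {m : ℕ} (A : Fin m → Fin m → Bool) : Fin m → Fin m → Set where
  here : ∀ {x} → Reach A x x
  step : ∀ {x y z} → A x y ≡ true → Reach A y z → Reach A x z

Connected : ∀ {m} → Graph m → Set
Connected G = ∀ x y → Reach (adj G) x y

removeAdj : ∀ {m} (G : Graph m) → EdgeSet G → Fin m → Fin m → Bool
removeAdj G F x y = adj G x y ∧ not (mem F x y)

IsEdgeCut : ∀ {m} (G : Graph m) → EdgeSet G → Set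
IsEdgeCut G F = Σ _ λ x → Σ _ λ y → ¬ Reach (removeAdj G F) x y

IsMinEdgeCut : ∀ {m} (G : Graph m) → EdgeSet G → Set
IsMinEdgeCut G F = IsEdgeCut G F × (∀ F' → IsEdgeCut G F' → size F ≤ size F')

IsTrivialCut : ∀ {m} (G : Graph m) → EdgeSet G → Set
IsTrivialCut G F = Σ _ λ v → ∀ x y → mem F x y ≡ (adj G x y ∧ (x == v ∨ y == v))

SuperEdgeConnected : ∀ {m} → Graph m → Set
SuperEdgeConnected G = Connected G × (∀ F → IsMinEdgeCut G F → IsTrivialCut G F)

-- κ'(G) = k : k is the minimum size of an edge cut, with the convention
-- κ'(K₁) = 0 for the one-vertex graph.
EdgeConnectivity : ∀ {m} → Graph (suc m) → ℕ → Set
EdgeConnectivity {m} G k =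
  (m ≡ 0 × k ≡ 0) ⊎ (Σ (EdgeSet G) λ F → IsMinEdgeCut G F × size F ≡ k)

-- A bipartition S of the vertices of H = G × K_n is read fibre by fibre: over
-- a vertex x of G the fibre A x is a bipartition of K_n, and the boundary of S
-- (counted over ordered pairs) is the sum over the edges xy of G of the number
-- of pairs of distinct vertices of K_n on which A x and A y disagree (∂-⊗K).
-- Hence either all fibres are constant and S lifts a bipartition T of G, with
-- boundary n(n − 1) times that of T (∂-lift), or some fibre is proper, which
-- costs at least n − 1 crossing pairs on every edge at its vertex x₀
-- (crossing-proper), so the boundary is at least 2(n − 1) deg x₀
-- (split-bound).  Comparing the lift of a minimum cut, n(n − 1) · 2κ'(G),
-- with the star of a vertex, 2(n − 1) δ(G), gives both directions: if
-- n κ' ≤ δ the lifted minimum cut is a minimum cut of H that is not a star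
-- (Forward); if δ < n κ' every minimum cut of H attains the star bound, and
-- the analysis of equality (Tight) shows that it is a star except when n = 3
-- and G = K₂ (Backward).
module Submission where

open import Defs
open import Data.Nat using (ℕ; suc; _*_; _≤_; _<_)
open import Data.Product using (_×_)
open import Relation.Nullary using (¬_)
open import Relation.Binary.PropositionalEquality using (_≡_)
open import Function.Bundles using (_⇔_)

open import Data.Bool using (Bool; true; false; _∧_; _∨_; not; if_then_else_; _xor_)
open import Data.Bool.Properties as BoolP
  using (∧-assoc; ∧-zeroʳ; ∧-identityʳ; ∧-conicalˡ; ∧-conicalʳ; not-involutive; xor-comm; true-xor; T-≡)
open import Data.Nat using (zero; _+_; z≤n; s≤s; _<?_; _≤?_)
open import Data.Nat.Properties
open import Data.Fin using (Fin; zero; suc; toℕ; combine; remQuot; _↑ˡ_; _↑ʳ_)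
import Data.Fin.Properties as FinP
open import Data.Product using (Σ; ∃; _,_; proj₁; proj₂)
open import Data.Sum using (_⊎_; inj₁; inj₂)
open import Data.Empty using (⊥; ⊥-elim)
open import Relation.Nullary using (yes; no)
open import Relation.Nullary.Decidable using (⌊_⌋; isYes≗does; dec-true; dec-false; toWitness)
open import Relation.Binary.PropositionalEquality
open import Function.Bundles using (mk⇔; Equivalence)
open import Data.Nat.Tactic.RingSolver using (solve-∀)
open import Algebra.Properties.Semiring.Sum +-*-semiring
  using (sum; sum-cong-≗; sum-replicate-zero; ∑-distrib-+; ∑-comm; *-distribˡ-sum)

ι : Bool → ℕ
ι true  = 1
ι false = 0

ι≤1 : ∀ b → ι b ≤ 1
ι≤1 true  = ≤-refl
ι≤1 false = z≤n

ι-∧ : ∀ b c → ι (b ∧ c) ≡ ι b * ι c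
ι-∧ true  c = sym (+-identityʳ (ι c))
ι-∧ false c = refl

ι-not : ∀ b → ι b + ι (not b) ≡ 1
ι-not true  = refl
ι-not false = refl

ι-positive : ∀ {b} → 0 < ι b → b ≡ true
ι-positive {true} _ = refl

ι-mono : ∀ {b c} → (b ≡ true → c ≡ true) → ι b ≤ ι c
ι-mono {false} h = z≤n
ι-mono {true}  h rewrite h refl = ≤-refl

true≢false : true ≡ false → ⊥
true≢false ()

xor-true : ∀ b → (b xor true) ≡ not b
xor-true b = trans (xor-comm b true) (true-xor b)

xor-false : ∀ b → (b xor false) ≡ b
xor-false b = xor-comm b false

xor-agree : ∀ {s t} → (s xor t) ≡ false → s ≡ t
xor-agree {true}  {true}  _ = refl
xor-agree {false} {false} _ = refl

xor-disagree : ∀ {s t} → (s xor t) ≡ true → s ≡ not t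
xor-disagree {true}  {false} _ = refl
xor-disagree {false} {true}  _ = refl

∑ : ∀ {m} → (Fin m → ℕ) → ℕ
∑ = sum

sumFin≡∑ : ∀ {m} (f : Fin m → ℕ) → sumFin f ≡ ∑ f
sumFin≡∑ {zero}  f = refl
sumFin≡∑ {suc m} f = cong (f zero +_) (sumFin≡∑ (λ i → f (suc i)))

∑-cong : ∀ {m} {f g : Fin m → ℕ} → (∀ i → f i ≡ g i) → ∑ f ≡ ∑ g
∑-cong = sum-cong-≗

∑-zero : ∀ m → ∑ {m} (λ _ → 0) ≡ 0
∑-zero = sum-replicate-zero

∑-const : ∀ m c → ∑ {m} (λ _ → c) ≡ m * c
∑-const zero    c = refl
∑-const (suc m) c = cong (c +_) (∑-const m c)

∑-scale : ∀ {m} k (f : Fin m → ℕ) → ∑ (λ i → k * f i) ≡ k * ∑ f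
∑-scale k f = sym (*-distribˡ-sum k f)

∑-mono : ∀ {m} {f g : Fin m → ℕ} → (∀ i → f i ≤ g i) → ∑ f ≤ ∑ g
∑-mono {zero}  h = z≤n
∑-mono {suc m} h = +-mono-≤ (h zero) (∑-mono (λ i → h (suc i)))

∑-mono-< : ∀ {m} {f g : Fin m → ℕ} → (∀ i → f i ≤ g i) → ∀ j → f j < g j → ∑ f < ∑ g
∑-mono-< {suc m} h zero    lt = +-mono-<-≤ lt (∑-mono (λ i → h (suc i)))
∑-mono-< {suc m} h (suc j) lt = +-mono-≤-< (h zero) (∑-mono-< (λ i → h (suc i)) j lt)

term≤∑ : ∀ {m} (f : Fin m → ℕ) i → f i ≤ ∑ f
term≤∑ f zero    = m≤m+n (f zero) _
term≤∑ f (suc i) = ≤-trans (term≤∑ (λ j → f (suc j)) i) (m≤n+m _ (f zero))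

∑≡0⇒ : ∀ {m} (f : Fin m → ℕ) → ∑ f ≡ 0 → ∀ i → f i ≡ 0
∑≡0⇒ f e i = n≤0⇒n≡0 (subst (f i ≤_) e (term≤∑ f i))

∑-positive : ∀ {m} (f : Fin m → ℕ) → 0 < ∑ f → ∃ λ i → 0 < f i
∑-positive {suc m} f p with f zero in eq
... | suc _ = zero , subst (0 <_) (sym eq) (s≤s z≤n)
... | zero  with ∑-positive (λ i → f (suc i)) p
...   | i , q = suc i , q

∑-tight : ∀ {m} {f g : Fin m → ℕ} → (∀ i → f i ≤ g i) → ∑ g ≤ ∑ f → ∀ i → f i ≡ g i
∑-tight le reverse i with m≤n⇒m<n∨m≡n (le i)
... | inj₂ equal = equal
... | inj₁ less  = ⊥-elim (<⇒≱ (∑-mono-< le i less) reverse)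

∑∑-tight : ∀ {m} {f g : Fin m → Fin m → ℕ} → (∀ x y → f x y ≤ g x y) →
           ∑ (λ x → ∑ (g x)) ≤ ∑ (λ x → ∑ (f x)) → ∀ x y → f x y ≡ g x y
∑∑-tight le reverse x =
  ∑-tight (le x) (≤-reflexive (sym (∑-tight (λ x → ∑-mono (le x)) reverse x)))

∑-splitAt : ∀ b c (f : Fin (b + c) → ℕ) → ∑ f ≡ ∑ (λ i → f (i ↑ˡ c)) + ∑ (λ j → f (b ↑ʳ j))
∑-splitAt zero    c f = refl
∑-splitAt (suc b) c f =
  trans (cong (f zero +_) (∑-splitAt b c (λ i → f (suc i)))) (sym (+-assoc (f zero) _ _))

∑-combine : ∀ m n (f : Fin (m * n) → ℕ) → ∑ f ≡ ∑ {m} (λ x → ∑ {n} (λ u → f (combine x u)))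
∑-combine zero    n f = refl
∑-combine (suc m) n f =
  trans (∑-splitAt n (m * n) f) (cong (∑ (λ u → f (combine {suc m} {n} zero u)) +_)
                                      (∑-combine m n (λ j → f (n ↑ʳ j))))

==-refl : ∀ {m} (x : Fin m) → (x == x) ≡ true
==-refl x = trans (isYes≗does (x FinP.≟ x)) (dec-true (x FinP.≟ x) refl)

==-false : ∀ {m} {x y : Fin m} → ¬ x ≡ y → (x == y) ≡ false
==-false {x = x} {y} ne = trans (isYes≗does (x FinP.≟ y)) (dec-false (x FinP.≟ y) ne)

==-true : ∀ {m} {x y : Fin m} → (x == y) ≡ true → x ≡ y
==-true e = toWitness (Equivalence.from T-≡ e)

==-sym : ∀ {m} (x y : Fin m) → (x == y) ≡ (y == x)
==-sym x y with x FinP.≟ y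
... | yes refl = sym (==-refl x)
... | no ne    = sym (==-false (λ e → ne (sym e)))

combine-== : ∀ {m n} (x y : Fin m) (u w : Fin n) → (combine x u == combine y w) ≡ (x == y ∧ u == w)
combine-== x y u w with x FinP.≟ y | u FinP.≟ w
... | yes refl | yes refl = ==-refl (combine x u)
... | yes refl | no ne    = ==-false (λ e → ne (FinP.combine-injectiveʳ x u x w e))
... | no ne    | _        = ==-false (λ e → ne (FinP.combine-injectiveˡ x u y w e))

∑-delta : ∀ {m} (a : Fin m) (f : Fin m → ℕ) → ∑ (λ i → ι (i == a) * f i) ≡ f a
∑-delta {suc m} zero f = begin
  ι (_==_ {suc m} zero zero) * f zero + ∑ (λ i → ι (suc i == zero) * f (suc i))
    ≡⟨ cong₂ _+_ (+-identityʳ (f zero)) (trans (∑-cong off) (∑-zero m)) ⟩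
  f zero + 0
    ≡⟨ +-identityʳ (f zero) ⟩
  f zero ∎
  where
  open ≡-Reasoning
  off : ∀ i → ι (suc i == zero) * f (suc i) ≡ 0
  off i = cong (λ b → ι b * f (suc i)) (==-false {x = suc i} {y = zero} (λ ()))
∑-delta {suc m} (suc a) f = begin
  ι (zero == suc a) * f zero + ∑ (λ i → ι (suc i == suc a) * f (suc i))
    ≡⟨ cong₂ _+_ (cong (λ b → ι b * f zero) (==-false {x = zero} {y = suc a} (λ ())))
                 (∑-cong (λ i → cong (λ b → ι b * f (suc i)) (suc-== i))) ⟩
  ∑ (λ i → ι (i == a) * f (suc i))
    ≡⟨ ∑-delta a (λ i → f (suc i)) ⟩
  f (suc a) ∎
  where
  open ≡-Reasoning
  suc-== : ∀ i → (suc i == suc a) ≡ (i == a)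
  suc-== i = trans (isYes≗does (suc i FinP.≟ suc a)) (sym (isYes≗does (i FinP.≟ a)))

count-point : ∀ {m} (a : Fin m) → ∑ (λ i → ι (i == a)) ≡ 1
count-point a = trans (∑-cong (λ i → sym (*-identityʳ (ι (i == a))))) (∑-delta a (λ _ → 1))

two-terms : ∀ {m} (f : Fin m → ℕ) i j → ¬ i ≡ j → 1 ≤ f i → 1 ≤ f j → 2 ≤ ∑ f
two-terms f i j ne fi fj =
  subst (_≤ ∑ f) (trans (∑-distrib-+ (λ k → ι (k == i)) (λ k → ι (k == j)))
                        (cong₂ _+_ (count-point i) (count-point j)))
        (∑-mono bound)
  where
  bound : ∀ k → ι (k == i) + ι (k == j) ≤ f k
  bound k with k FinP.≟ i | k FinP.≟ j
  ... | yes refl | yes refl = ⊥-elim (ne refl)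
  ... | yes refl | no _     = subst (_≤ f k) (sym (+-identityʳ 1)) fi
  ... | no _     | yes refl = fj
  ... | no _     | no _     = z≤n

findTrue : ∀ {m} (f : Fin m → Bool) → (∃ λ i → f i ≡ true) ⊎ (∀ i → f i ≡ false)
findTrue {zero}  f = inj₂ (λ ())
findTrue {suc m} f with f zero in eq
... | true  = inj₁ (zero , eq)
... | false with findTrue (λ i → f (suc i))
...   | inj₁ (i , p) = inj₁ (suc i , p)
...   | inj₂ h       = inj₂ λ { zero → eq ; (suc i) → h i }

single-point : ∀ {m} (P : Fin m → Bool) → ∑ (λ u → ι (P u)) ≡ 1 → ∃ λ u₀ → ∀ u → P u ≡ (u == u₀)
single-point {m} P e with findTrue P
... | inj₂ h = ⊥-elim (0≢1+n (trans (sym (trans (∑-cong (λ u → cong ι (h u))) (∑-zero m))) e))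
... | inj₁ (u₀ , p) = u₀ , at
  where
  at : ∀ u → P u ≡ (u == u₀)
  at u with u FinP.≟ u₀
  ... | yes refl = p
  ... | no ne with P u in q
  ...   | false = refl
  ...   | true  = ⊥-elim (<-irrefl (sym e) (two-terms (λ u → ι (P u)) u u₀ ne
                                          (≤-reflexive (cong ι (sym q))) (≤-reflexive (cong ι (sym p)))))

anyFin : ∀ {m} → (Fin m → Bool) → Bool
anyFin {zero}  f = false
anyFin {suc m} f = f zero ∨ anyFin (λ i → f (suc i))

any-intro : ∀ {m} (f : Fin m → Bool) i → f i ≡ true → anyFin f ≡ true
any-intro f zero e rewrite e = refl
any-intro f (suc i) e with f zero
... | true  = refl
... | false = any-intro (λ j → f (suc j)) i e

any-elim : ∀ {m} (f : Fin m → Bool) → anyFin f ≡ true → ∃ λ i → f i ≡ true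
any-elim {suc m} f e with f zero in eq
... | true  = zero , eq
... | false with any-elim (λ j → f (suc j)) e
...   | i , p = suc i , p

any-cong : ∀ {m} {f g : Fin m → Bool} → (∀ i → f i ≡ g i) → anyFin f ≡ anyFin g
any-cong {zero}  h = refl
any-cong {suc m} h = cong₂ _∨_ (h zero) (any-cong (λ i → h (suc i)))

reach-snoc : ∀ {m} {A : Fin m → Fin m → Bool} {x w z} → Reach A x w → A w z ≡ true → Reach A x z
reach-snoc here       e  = step e here
reach-snoc (step e r) e′ = step e (reach-snoc r e′)

reach-map : ∀ {m} {A B : Fin m → Fin m → Bool} → (∀ a b → A a b ≡ true → B a b ≡ true) →
            ∀ {x y} → Reach A x y → Reach B x y
reach-map h here       = here
reach-map h (step e r) = step (h _ _ e) (reach-map h r)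

reach-invariant : ∀ {m} {A : Fin m → Fin m → Bool} (P : Fin m → Set) →
                  (∀ a b → P a → A a b ≡ true → P b) → ∀ {x y} → P x → Reach A x y → P y
reach-invariant P h p here       = p
reach-invariant P h p (step e r) = reach-invariant P h (h _ _ p e) r

-- It
-- is computed by iterating the one-step extension R ↦ R ∪ A[R]; every
-- non-stationary step adds a vertex, so the iteration is stationary after N
-- steps, and its N-th stage contains x, is closed under A, and consists of
-- vertices reachable from x.
module ReachableSet {N : ℕ} (A : Fin N → Fin N → Bool) (x : Fin N) where
  extend : (Fin N → Bool) → Fin N → Bool
  extend R z = R z ∨ anyFin (λ w → R w ∧ A w z)

  stage : ℕ → Fin N → Bool
  stage zero    = λ z → z == x
  stage (suc t) = extend (stage t)

  stage-grows : ∀ t z → stage t z ≡ true → stage (suc t) z ≡ true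
  stage-grows t z e rewrite e = refl

  Stationary : ℕ → Set
  Stationary t = ∀ z → stage (suc t) z ≡ stage t z

  stationary-suc : ∀ t → Stationary t → Stationary (suc t)
  stationary-suc t s z = cong₂ _∨_ (s z) (any-cong (λ w → cong (_∧ A w z) (s w)))

  size-of : ℕ → ℕ
  size-of t = ∑ (λ z → ι (stage t z))

  step-adds-vertex : ∀ t → Stationary t ⊎ suc (size-of t) ≤ size-of (suc t)
  step-adds-vertex t with findTrue (λ z → stage (suc t) z ∧ not (stage t z))
  ... | inj₁ (z , e) = inj₂ (∑-mono-< (λ z → ι-mono (stage-grows t z)) z (new (stage t z) (stage (suc t) z) e))
    where
    new : ∀ a b → (b ∧ not a) ≡ true → ι a < ι b
    new false true _ = s≤s z≤n
  ... | inj₂ h = inj₁ λ z → same (stage t z) (stage (suc t) z) (stage-grows t z) (h z)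
    where
    same : ∀ a b → (a ≡ true → b ≡ true) → (b ∧ not a) ≡ false → b ≡ a
    same true  b     g _ = g refl
    same false false g _ = refl

  stationary-or-large : ∀ t → Stationary t ⊎ suc t ≤ size-of t
  stationary-or-large zero = inj₂ (subst (_≤ size-of zero) (cong ι (==-refl x)) (term≤∑ _ x))
  stationary-or-large (suc t) with stationary-or-large t
  ... | inj₁ s = inj₁ (stationary-suc t s)
  ... | inj₂ p with step-adds-vertex t
  ...   | inj₁ s = inj₁ (stationary-suc t s)
  ...   | inj₂ q = inj₂ (≤-trans (s≤s p) q)

  size-of≤N : ∀ t → size-of t ≤ N
  size-of≤N t = ≤-trans (∑-mono (λ z → ι≤1 (stage t z))) (≤-reflexive (trans (∑-const N 1) (*-identityʳ N)))

  stationary-N : Stationary N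
  stationary-N with stationary-or-large N
  ... | inj₁ s = s
  ... | inj₂ p = ⊥-elim (<-irrefl refl (≤-trans p (size-of≤N N)))

  reachable : Fin N → Bool
  reachable = stage N

  source : reachable x ≡ true
  source = contains x N (==-refl x)
    where
    contains : ∀ z t → stage zero z ≡ true → stage t z ≡ true
    contains z zero    e = e
    contains z (suc t) e = stage-grows t z (contains z t e)

  closed : ∀ z w → reachable z ≡ true → A z w ≡ true → reachable w ≡ true
  closed z w rz a = trans (sym (stationary-N w)) (into-extend (any-intro _ z (subst (λ b → (b ∧ A z w) ≡ true) (sym rz) a)))
    where
    into-extend : anyFin (λ w′ → stage N w′ ∧ A w′ w) ≡ true → stage (suc N) w ≡ true
    into-extend h with stage N w
    ... | true  = refl
    ... | false = h

  sound : ∀ z → reachable z ≡ true → Reach A x z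
  sound = walk N
    where
    walk : ∀ t z → stage t z ≡ true → Reach A x z
    walk zero z e with ==-true {x = z} e
    ... | refl = here
    walk (suc t) z e with stage t z in q
    ... | true  = walk t z q
    ... | false with any-elim (λ w → stage t w ∧ A w z) e
    ...   | w , p = reach-snoc (walk t w (∧-conicalˡ _ _ p)) (∧-conicalʳ _ _ p)

  complete : ∀ z → Reach A x z → reachable z ≡ true
  complete z = reach-invariant (λ z → reachable z ≡ true) closed source

  unreachable : ∀ z → ¬ Reach A x z → reachable z ≡ false
  unreachable z nr with reachable z in q
  ... | false = refl
  ... | true  = ⊥-elim (nr (sound z q))

reach? : ∀ {m} (A : Fin m → Fin m → Bool) a b → Reach A a b ⊎ ¬ Reach A a b
reach? A a b with ReachableSet.reachable A a b in q
... | true  = inj₁ (ReachableSet.sound A a b q)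
... | false = inj₂ λ r → true≢false (trans (sym (ReachableSet.complete A a b r)) q)

-- Edge cuts and vertex bipartitions.  Edge sets are counted over ordered
-- pairs, which counts every edge twice; bipartitions S are Boolean functions,
-- and Proper S says both sides are inhabited.
pairs : ∀ {m} → (Fin m → Fin m → Bool) → ℕ
pairs M = ∑ (λ x → ∑ (λ y → ι (M x y)))

pairs-cong : ∀ {m} {M M′ : Fin m → Fin m → Bool} → (∀ i j → M i j ≡ M′ i j) → pairs M ≡ pairs M′
pairs-cong h = ∑-cong (λ i → ∑-cong (λ j → cong ι (h i j)))

pairs-size : ∀ {m} {G : Graph m} (F : EdgeSet G) → pairs (mem F) ≡ 2 * size F
pairs-size {m} {G} F = begin
  pairs (mem F)                                                ≡⟨ ∑-cong (λ x → ∑-cong (both-orders x)) ⟩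
  ∑ (λ x → ∑ (λ y → once x y + once y x))                      ≡⟨ ∑-cong (λ x → ∑-distrib-+ (once x) (λ y → once y x)) ⟩
  ∑ (λ x → ∑ (once x) + ∑ (λ y → once y x))                    ≡⟨ ∑-distrib-+ (λ x → ∑ (once x)) (λ x → ∑ (λ y → once y x)) ⟩
  ∑ (λ x → ∑ (once x)) + ∑ (λ x → ∑ (λ y → once y x))          ≡⟨ cong (∑ (λ x → ∑ (once x)) +_) (∑-comm (λ x y → once y x)) ⟩
  ∑ (λ x → ∑ (once x)) + ∑ (λ x → ∑ (once x))                  ≡⟨ cong₂ _+_ size-as-∑ (trans size-as-∑ (sym (+-identityʳ _))) ⟩
  2 * size F ∎
  where
  open ≡-Reasoning
  once : Fin m → Fin m → ℕ
  once x y = if mem F x y then (if ⌊ toℕ x <? toℕ y ⌋ then 1 else 0) else 0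

  size-as-∑ : ∑ (λ x → ∑ (once x)) ≡ size F
  size-as-∑ = sym (trans (sumFin≡∑ (λ x → sumFin (once x))) (∑-cong (λ x → sumFin≡∑ (once x))))

  loop-free : ∀ x → mem F x x ≡ false
  loop-free x with mem F x x in e
  ... | false = refl
  ... | true  = ⊥-elim (true≢false (trans (sym (sub F x x e)) (adjIrrefl G x)))

  both-orders : ∀ x y → ι (mem F x y) ≡ once x y + once y x
  both-orders x y with toℕ x <? toℕ y | toℕ y <? toℕ x
  ... | yes p | yes q = ⊥-elim (<-asym p q)
  ... | yes p | no q rewrite memSym F y x with mem F x y
  ...   | true  = refl
  ...   | false = refl
  both-orders x y | no p | yes q rewrite memSym F y x with mem F x y
  ...   | true  = refl
  ...   | false = refl
  both-orders x y | no p | no q with FinP.toℕ-injective (≤-antisym (≮⇒≥ q) (≮⇒≥ p))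
  ... | refl rewrite loop-free x = refl

pairs-mono : ∀ {m} {M M′ : Fin m → Fin m → Bool} → (∀ i j → M i j ≡ true → M′ i j ≡ true) → pairs M ≤ pairs M′
pairs-mono h = ∑-mono (λ i → ∑-mono (λ j → ι-mono (h i j)))

pairs-mono-< : ∀ {m} {M M′ : Fin m → Fin m → Bool} → (∀ i j → M i j ≡ true → M′ i j ≡ true) →
               ∀ i j → M i j ≡ false → M′ i j ≡ true → pairs M < pairs M′
pairs-mono-< h i j absent present =
  ∑-mono-< (λ i → ∑-mono (λ j → ι-mono (h i j))) i
    (∑-mono-< (λ j → ι-mono (h i j)) j (subst₂ (λ a b → ι a < ι b) (sym absent) (sym present) (s≤s z≤n)))

size-mono : ∀ {m} {G : Graph m} (F F′ : EdgeSet G) → (∀ i j → mem F i j ≡ true → mem F′ i j ≡ true) →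
            size F ≤ size F′
size-mono F F′ h = *-cancelˡ-≤ 2 (subst₂ _≤_ (pairs-size F) (pairs-size F′) (pairs-mono h))

Proper : ∀ {m} → (Fin m → Bool) → Set
Proper S = (∃ λ a → S a ≡ true) × (∃ λ b → S b ≡ false)

boundary : ∀ {m} (G : Graph m) (S : Fin m → Bool) → EdgeSet G
boundary G S = record
  { mem    = λ i j → adj G i j ∧ (S i xor S j)
  ; memSym = λ i j → cong₂ _∧_ (adjSym G i j) (xor-comm (S i) (S j))
  ; sub    = λ i j e → ∧-conicalˡ _ _ e }

∂ : ∀ {m} (G : Graph m) (S : Fin m → Bool) → ℕ
∂ G S = pairs (mem (boundary G S))

side-invariant : ∀ {m} (G : Graph m) (S : Fin m → Bool) {F : Fin m → Fin m → Bool} →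
                 (∀ i j → F i j ≡ true → (S i xor S j) ≡ false) →
                 ∀ {a b} → Reach F a b → S a ≡ S b
side-invariant G S avoid r =
  sym (reach-invariant (λ z → S z ≡ _) (λ i j p e → trans (sym (xor-agree (avoid i j e))) p) refl r)

boundary-cut : ∀ {m} (G : Graph m) (S : Fin m → Bool) → Proper S → IsEdgeCut G (boundary G S)
boundary-cut G S ((a , sa) , (b , sb)) =
  a , b , λ r → true≢false (trans (sym sa) (trans (side-invariant G S avoid r) sb))
  where
  avoid : ∀ i j → removeAdj G (boundary G S) i j ≡ true → (S i xor S j) ≡ false
  avoid i j e with S i xor S j | adj G i j
  ... | false | _    = refl
  ... | true  | true = ⊥-elim (true≢false (sym e))

-- For an edge cut F separating a from b, the side S of a (the vertices
-- reachable from a in G − F) is a proper bipartition whose boundary lies in F.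
cut-contains-boundary : ∀ {m} (G : Graph m) (F : EdgeSet G) → IsEdgeCut G F →
  Σ (Fin m → Bool) λ S → Proper S × (∀ i j → mem (boundary G S) i j ≡ true → mem F i j ≡ true)
cut-contains-boundary G F (a , b , a↛b) = reachable , ((a , source) , (b , unreachable b a↛b)) , inside
  where
  open ReachableSet (removeAdj G F) a

  same-side : ∀ i j → removeAdj G F i j ≡ true → removeAdj G F j i ≡ true → (reachable i xor reachable j) ≡ false
  same-side i j e e′ with reachable i in p | reachable j in q
  ... | true  | true  = refl
  ... | false | false = refl
  ... | true  | false = ⊥-elim (true≢false (trans (sym (closed i j p e)) q))
  ... | false | true  = ⊥-elim (true≢false (trans (sym (closed j i q e′)) p))

  inside : ∀ i j → mem (boundary G reachable) i j ≡ true → mem F i j ≡ true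
  inside i j e with mem F i j in q
  ... | true  = refl
  ... | false = ⊥-elim (true≢false (trans (sym (∧-conicalʳ _ _ e)) (same-side i j kept kept′)))
    where
    edge : adj G i j ≡ true
    edge = ∧-conicalˡ _ _ e
    kept : removeAdj G F i j ≡ true
    kept rewrite q | edge = refl
    kept′ : removeAdj G F j i ≡ true
    kept′ rewrite memSym F j i | q | adjSym G j i | edge = refl

cut-≥-boundary : ∀ {m} (G : Graph m) (F : EdgeSet G) → IsEdgeCut G F →
  Σ (Fin m → Bool) λ S → Proper S × size (boundary G S) ≤ size F
cut-≥-boundary G F cut with cut-contains-boundary G F cut
... | S , proper , inside = S , proper , size-mono (boundary G S) F inside

minCut-is-boundary : ∀ {m} (G : Graph m) (F : EdgeSet G) → IsMinEdgeCut G F →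
  Σ (Fin m → Bool) λ S → Proper S × (∀ i j → mem F i j ≡ mem (boundary G S) i j)
minCut-is-boundary G F (cut , minimal) with cut-contains-boundary G F cut
... | S , proper , inside = S , proper , equal
  where
  equal : ∀ i j → mem F i j ≡ mem (boundary G S) i j
  equal i j with mem F i j in p | mem (boundary G S) i j in q
  ... | true  | true  = refl
  ... | false | false = refl
  ... | false | true  = ⊥-elim (true≢false (trans (sym (inside i j q)) p))
  ... | true  | false = ⊥-elim (<⇒≱ smaller (minimal (boundary G S) (boundary-cut G S proper)))
    where
    smaller : size (boundary G S) < size F
    smaller = *-cancelˡ-< 2 _ _ (subst₂ _<_ (pairs-size (boundary G S)) (pairs-size F)
                                       (pairs-mono-< inside i j q p))

minCut-≤-∂ : ∀ {m} (G : Graph m) (F : EdgeSet G) → IsMinEdgeCut G F →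
             ∀ S → Proper S → 2 * size F ≤ ∂ G S
minCut-≤-∂ G F (_ , minimal) S proper =
  subst (2 * size F ≤_) (sym (pairs-size (boundary G S)))
        (*-monoʳ-≤ 2 (minimal (boundary G S) (boundary-cut G S proper)))

least-boundary⇒minCut : ∀ {m} (G : Graph m) (S₀ : Fin m → Bool) → Proper S₀ →
                        (∀ S → Proper S → ∂ G S₀ ≤ ∂ G S) → IsMinEdgeCut G (boundary G S₀)
least-boundary⇒minCut G S₀ proper least = boundary-cut G S₀ proper , minimal
  where
  minimal : ∀ F → IsEdgeCut G F → size (boundary G S₀) ≤ size F
  minimal F cut with cut-≥-boundary G F cut
  ... | S , proper′ , smaller = ≤-trans (*-cancelˡ-≤ 2 (subst₂ _≤_ (pairs-size (boundary G S₀))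
                                         (pairs-size (boundary G S)) (least S proper′))) smaller

vertex-like⇒trivial : ∀ {m} (G : Graph m) (F : EdgeSet G) (S : Fin m → Bool) (v : Fin m) →
                      (∀ i j → mem F i j ≡ mem (boundary G S) i j) →
                      (∀ i j → (S i xor S j) ≡ ((i == v) xor (j == v))) → IsTrivialCut G F
vertex-like⇒trivial G F S v is-boundary like-v = v , λ i j →
  trans (is-boundary i j) (trans (cong (adj G i j ∧_) (like-v i j)) (edge-at-v i j))
  where
  -- an edge cannot have both ends equal to v
  edge-at-v : ∀ i j → (adj G i j ∧ ((i == v) xor (j == v))) ≡ (adj G i j ∧ ((i == v) ∨ (j == v)))
  edge-at-v i j with i == v in p | j == v in q
  ... | true  | true  = trans (∧-zeroʳ (adj G i j)) (sym (cong (_∧ true) loop))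
    where
    loop : adj G i j ≡ false
    loop = subst (λ k → adj G i k ≡ false) (trans (==-true p) (sym (==-true q))) (adjIrrefl G i)
  ... | true  | false = refl
  ... | false | _     = refl

closed-∂≡0 : ∀ {m} (G : Graph m) (S : Fin m → Bool) →
             (∀ a b → S a ≡ true → adj G a b ≡ true → S b ≡ true) → ∂ G S ≡ 0
closed-∂≡0 {m} G S closed =
  trans (∑-cong (λ x → trans (∑-cong (λ y → no-crossing x y)) (∑-zero m))) (∑-zero m)
  where
  no-crossing : ∀ x y → ι (adj G x y ∧ (S x xor S y)) ≡ 0
  no-crossing x y with adj G x y in e | S x in p | S y in q
  ... | false | _     | _     = refl
  ... | true  | true  | true  = refl
  ... | true  | false | false = refl
  ... | true  | true  | false = ⊥-elim (true≢false (trans (sym (closed x y p e)) q))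
  ... | true  | false | true  = ⊥-elim (true≢false (trans (sym (closed y x q (trans (adjSym G y x) e))) p))

crossing-edge : ∀ {m} (G : Graph m) (S : Fin m → Bool) → 0 < ∂ G S →
                ∃ λ p → ∃ λ q → S p ≡ true × S q ≡ false × adj G p q ≡ true
crossing-edge G S positive with ∑-positive _ positive
... | x , px with ∑-positive (λ y → ι (adj G x y ∧ (S x xor S y))) px
...   | y , py = orient (ι-positive py)
  where
  orient : (adj G x y ∧ (S x xor S y)) ≡ true → ∃ λ p → ∃ λ q → S p ≡ true × S q ≡ false × adj G p q ≡ true
  orient e with S x in sx | S y in sy
  ... | true  | false = x , y , sx , sy , ∧-conicalˡ _ _ e
  ... | false | true  = y , x , sy , sx , trans (adjSym G y x) (∧-conicalˡ _ _ e)
  ... | true  | true  = ⊥-elim (true≢false (sym (∧-conicalʳ (adj G x y) false e)))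
  ... | false | false = ⊥-elim (true≢false (sym (∧-conicalʳ (adj G x y) false e)))

∂≡0-separates : ∀ {m} (G : Graph m) (S : Fin m → Bool) → ∂ G S ≡ 0 →
                ∀ a b → S a ≡ true → S b ≡ false → ¬ Reach (adj G) a b
∂≡0-separates G S e a b sa sb r = true≢false (trans (sym sa) (trans (side-invariant G S avoid r) sb))
  where
  avoid : ∀ i j → adj G i j ≡ true → (S i xor S j) ≡ false
  avoid i j a with S i xor S j in q
  ... | false = refl
  ... | true  = ⊥-elim (0≢1+n (trans (sym no-pair) (cong₂ (λ s t → ι (s ∧ t)) a q)))
    where
    no-pair : ι (adj G i j ∧ (S i xor S j)) ≡ 0
    no-pair = ∑≡0⇒ _ (∑≡0⇒ _ e i) j

degree-as-∑ : ∀ {m} (G : Graph m) x → degree G x ≡ ∑ (λ y → ι (adj G x y))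
degree-as-∑ G x = trans (sumFin≡∑ (λ y → if adj G x y then 1 else 0)) (∑-cong (λ y → if-ι (adj G x y)))
  where
  if-ι : ∀ b → (if b then 1 else 0) ≡ ι b
  if-ι true  = refl
  if-ι false = refl

neighbour⇒degree≥1 : ∀ {m} (G : Graph m) {x y} → adj G x y ≡ true → 1 ≤ degree G x
neighbour⇒degree≥1 G {x} {y} e =
  subst (1 ≤_) (sym (degree-as-∑ G x))
        (subst (λ b → ι b ≤ ∑ (λ z → ι (adj G x z))) e (term≤∑ (λ z → ι (adj G x z)) y))

degree≥1⇒neighbour : ∀ {m} (G : Graph m) x → 1 ≤ degree G x → ∃ λ y → adj G x y ≡ true
degree≥1⇒neighbour G x p with ∑-positive (λ y → ι (adj G x y)) (subst (1 ≤_) (degree-as-∑ G x) p)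
... | y , q = y , ι-positive q

adjacent⇒distinct : ∀ {m} (G : Graph m) {x y} → adj G x y ≡ true → ¬ x ≡ y
adjacent⇒distinct G {x} e refl = true≢false (trans (sym e) (adjIrrefl G x))

δ≤degree : ∀ {m} (G : Graph (suc m)) x → δ G ≤ degree G x
δ≤degree G = minFin-≤ (degree G)
  where
  minFin-≤ : ∀ {m} (f : Fin (suc m) → ℕ) i → minFin f ≤ f i
  minFin-≤ {zero}  f zero    = ≤-refl
  minFin-≤ {suc m} f zero    = m⊓n≤m (f zero) _
  minFin-≤ {suc m} f (suc i) = ≤-trans (m⊓n≤n (f zero) _) (minFin-≤ (λ j → f (suc j)) i)

δ-attained : ∀ {m} (G : Graph (suc m)) → ∃ λ x → δ G ≡ degree G x
δ-attained G = minFin-attained (degree G)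
  where
  minFin-attained : ∀ {m} (f : Fin (suc m) → ℕ) → ∃ λ i → minFin f ≡ f i
  minFin-attained {zero}  f = zero , refl
  minFin-attained {suc m} f with f zero ≤? minFin (λ j → f (suc j))
  ... | yes p = zero , m≤n⇒m⊓n≡m p
  ... | no p with minFin-attained (λ j → f (suc j))
  ...   | i , e = suc i , trans (m≥n⇒m⊓n≡n (≰⇒≥ p)) e

-- A graph with a nonempty minimum edge cut is connected: otherwise the
-- empty edge set would be a smaller cut.
minCut-nonempty⇒connected : ∀ {m} (G : Graph m) (F : EdgeSet G) → IsMinEdgeCut G F → 1 ≤ size F → Connected G
minCut-nonempty⇒connected {m} G F (_ , minimal) nonempty a b with reach? (adj G) a b
... | inj₁ r = r
... | inj₂ a↛b = ⊥-elim (<⇒≱ nonempty (≤-trans (minimal ∅ (a , b , λ r → a↛b (reach-map keep r))) ∅-empty))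
  where
  ∅ : EdgeSet G
  ∅ = record { mem = λ _ _ → false ; memSym = λ _ _ → refl ; sub = λ _ _ () }
  ∅-empty : size ∅ ≤ 0
  ∅-empty = *-cancelˡ-≤ 2 (subst (_≤ 0) (pairs-size ∅) (≤-reflexive no-pairs))
    where
    no-pairs : pairs (mem ∅) ≡ 0
    no-pairs = trans (∑-cong {m} (λ x → ∑-zero m)) (∑-zero m)
  keep : ∀ i j → removeAdj G ∅ i j ≡ true → adj G i j ≡ true
  keep i j e = trans (sym (∧-identityʳ (adj G i j))) e

connected⇒degree≥1 : ∀ {m} (G : Graph m) → Connected G → (a b : Fin m) → ¬ a ≡ b → ∀ x → 1 ≤ degree G x
connected⇒degree≥1 G conn a b a≢b x = first-step (conn x (proj₁ other)) (proj₂ other)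
  where
  other : ∃ λ y → ¬ x ≡ y
  other with x FinP.≟ a
  ... | yes refl = b , a≢b
  ... | no x≢a   = a , x≢a
  first-step : ∀ {y} → Reach (adj G) x y → ¬ x ≡ y → 1 ≤ degree G x
  first-step here       x≢y = ⊥-elim (x≢y refl)
  first-step (step e _) _   = neighbour⇒degree≥1 G e

identity-iso : (G : Graph 2) → adj G zero (suc zero) ≡ true → Iso G (K 2)
identity-iso G e = record
  { to = λ x → x ; from = λ x → x ; from∘to = λ _ → refl ; to∘from = λ _ → refl ; preserve = same }
  where
  same : ∀ x y → adj (K 2) x y ≡ adj G x y
  same zero       zero       = sym (adjIrrefl G zero)
  same zero       (suc zero) = sym e
  same (suc zero) zero       = sym (trans (adjSym G (suc zero) zero) e)
  same (suc zero) (suc zero) = sym (adjIrrefl G (suc zero))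

two-vertices⇒K₂ : ∀ {m} (G : Graph (suc m)) (x y : Fin (suc m)) → adj G x y ≡ true →
                  (∀ w → w ≡ x ⊎ w ≡ y) → Iso G (K 2)
two-vertices⇒K₂ {zero} G zero zero e _ = ⊥-elim (adjacent⇒distinct G e refl)
two-vertices⇒K₂ {suc zero} G zero (suc zero) e _ = identity-iso G e
two-vertices⇒K₂ {suc zero} G (suc zero) zero e _ = identity-iso G (trans (adjSym G zero (suc zero)) e)
two-vertices⇒K₂ {suc zero} G zero zero e _ = ⊥-elim (adjacent⇒distinct G e refl)
two-vertices⇒K₂ {suc zero} G (suc zero) (suc zero) e _ = ⊥-elim (adjacent⇒distinct G e refl)
two-vertices⇒K₂ {suc (suc m)} G x y e cover = ⊥-elim (pigeonhole (cover zero) (cover (suc zero)) (cover (suc (suc zero))))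
  where
  distinct : ∀ {i j w} → ¬ i ≡ j → i ≡ w → j ≡ w → ⊥
  distinct i≢j p q = i≢j (trans p (sym q))
  pigeonhole : zero ≡ x ⊎ zero ≡ y → suc zero ≡ x ⊎ suc zero ≡ y → suc (suc zero) ≡ x ⊎ suc (suc zero) ≡ y → ⊥
  pigeonhole (inj₁ p) (inj₁ q) _        = distinct (λ ()) p q
  pigeonhole (inj₂ p) (inj₂ q) _        = distinct (λ ()) p q
  pigeonhole (inj₁ p) _        (inj₁ q) = distinct (λ ()) p q
  pigeonhole (inj₂ p) _        (inj₂ q) = distinct (λ ()) p q
  pigeonhole _        (inj₁ p) (inj₁ q) = distinct (λ ()) p q
  pigeonhole _        (inj₂ p) (inj₂ q) = distinct (λ ()) p q

-- For two bipartitions P, Q of the vertex set of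
-- K_n, crossing P Q counts the ordered pairs (u , w) of distinct vertices
-- with P u ≠ Q w; these are the edges of G × K_n between the fibres over the
-- ends of an edge of G that cross the bipartition.
crossing : ∀ {n} → (Fin n → Bool) → (Fin n → Bool) → ℕ
crossing P Q = ∑ (λ u → ∑ (λ w → ι (not (u == w) ∧ (P u xor Q w))))

crossing-cong : ∀ {n} {P P′ Q Q′ : Fin n → Bool} → (∀ u → P u ≡ P′ u) → (∀ u → Q u ≡ Q′ u) →
                crossing P Q ≡ crossing P′ Q′
crossing-cong hp hq = ∑-cong (λ u → ∑-cong (λ w → cong₂ (λ s t → ι (not (u == w) ∧ (s xor t))) (hp u) (hq w)))

crossing-sym : ∀ {n} (P Q : Fin n → Bool) → crossing P Q ≡ crossing Q P
crossing-sym P Q = trans (∑-comm (λ u w → ι (not (u == w) ∧ (P u xor Q w))))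
  (∑-cong (λ w → ∑-cong (λ u → cong₂ (λ s t → ι (not s ∧ t)) (==-sym u w) (xor-comm (P u) (Q w)))))

complement : ∀ {n} → (Fin n → Bool) → Fin n → Bool
complement P u = not (P u)

crossing-complement : ∀ {n} (P Q : Fin n → Bool) → crossing P Q ≡ crossing (complement P) (complement Q)
crossing-complement P Q =
  ∑-cong (λ u → ∑-cong (λ w → cong (λ t → ι (not (u == w) ∧ t)) (sym (not-xor-not (P u) (Q w)))))
  where
  not-xor-not : ∀ s t → (not s xor not t) ≡ (s xor t)
  not-xor-not true  t = refl
  not-xor-not false t = not-involutive t

ones zeros : ∀ {n} → (Fin n → Bool) → ℕ
ones  P = ∑ (λ u → ι (P u))
zeros P = ones (complement P)

ones+zeros : ∀ {n} (P : Fin n → Bool) → ones P + zeros P ≡ n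
ones+zeros {n} P = begin
  ones P + zeros P             ≡⟨ sym (∑-distrib-+ (λ u → ι (P u)) (λ u → ι (not (P u)))) ⟩
  ∑ (λ u → ι (P u) + ι (not (P u))) ≡⟨ ∑-cong (λ u → ι-not (P u)) ⟩
  ∑ {n} (λ _ → 1)              ≡⟨ ∑-const n 1 ⟩
  n * 1                        ≡⟨ *-identityʳ n ⟩
  n ∎
  where open ≡-Reasoning

column : ∀ {n} → (Fin n → Bool) → (Fin n → Bool) → Fin n → ℕ
column P Q w = ∑ (λ u → ι (not (u == w) ∧ (P u xor Q w)))

crossing-by-columns : ∀ {n} (P Q : Fin n → Bool) → crossing P Q ≡ ∑ (column P Q)
crossing-by-columns P Q = ∑-comm (λ u w → ι (not (u == w) ∧ (P u xor Q w)))

other-side : ∀ {n} (P : Fin n → Bool) → Bool → ℕ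
other-side P true  = zeros P
other-side P false = ones P

side-count : ∀ {n} (P : Fin n → Bool) t → ∑ (λ u → ι (P u xor t)) ≡ other-side P t
side-count P true  = ∑-cong (λ u → cong ι (xor-true (P u)))
side-count P false = ∑-cong (λ u → cong ι (xor-false (P u)))

column-total : ∀ {n} (P Q : Fin n → Bool) w → column P Q w + ι (P w xor Q w) ≡ other-side P (Q w)
column-total P Q w = begin
  column P Q w + ι (P w xor Q w)
    ≡⟨ cong (column P Q w +_) (sym (∑-delta w (λ u → ι (P u xor Q w)))) ⟩
  column P Q w + ∑ (λ u → ι (u == w) * ι (P u xor Q w))
    ≡⟨ sym (∑-distrib-+ _ (λ u → ι (u == w) * ι (P u xor Q w))) ⟩
  ∑ (λ u → ι (not (u == w) ∧ (P u xor Q w)) + ι (u == w) * ι (P u xor Q w))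
    ≡⟨ ∑-cong (λ u → split (u == w) (P u xor Q w)) ⟩
  ∑ (λ u → ι (P u xor Q w))
    ≡⟨ side-count P (Q w) ⟩
  other-side P (Q w) ∎
  where
  open ≡-Reasoning
  split : ∀ e b → ι (not e ∧ b) + ι e * ι b ≡ ι b
  split true  b = +-identityʳ (ι b)
  split false b = +-identityʳ (ι b)

crossing-to-constant : ∀ {n} (P Q : Fin n → Bool) t → (∀ w → Q w ≡ t) →
                       crossing P Q + other-side P t ≡ n * other-side P t
crossing-to-constant {n} P Q t const = begin
  crossing P Q + other-side P t
    ≡⟨ cong₂ _+_ (crossing-by-columns P Q) (sym (side-count P t)) ⟩
  ∑ (column P Q) + ∑ (λ w → ι (P w xor t))
    ≡⟨ sym (∑-distrib-+ (column P Q) (λ w → ι (P w xor t))) ⟩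
  ∑ (λ w → column P Q w + ι (P w xor t))
    ≡⟨ ∑-cong (λ w → subst (λ s → column P Q w + ι (P w xor s) ≡ other-side P s) (const w) (column-total P Q w)) ⟩
  ∑ {n} (λ _ → other-side P t)
    ≡⟨ ∑-const n (other-side P t) ⟩
  n * other-side P t ∎
  where
  open ≡-Reasoning

single-point-bound : ∀ {n} (P Q : Fin n → Bool) → ones P ≡ 1 →
                     zeros P + ones Q * zeros P ≤ crossing P Q + 2 * ones Q
single-point-bound P Q single = begin
  zeros P + ones Q * zeros P
    ≡⟨ cong (zeros P +_) (trans (*-comm (ones Q) (zeros P)) (sym (∑-scale (zeros P) (λ w → ι (Q w))))) ⟩
  ∑ (λ w → ι (not (P w))) + ∑ (λ w → zeros P * ι (Q w))
    ≡⟨ sym (∑-distrib-+ (λ w → ι (not (P w))) (λ w → zeros P * ι (Q w))) ⟩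
  ∑ (λ w → ι (not (P w)) + zeros P * ι (Q w))
    ≤⟨ ∑-mono (λ w → columnwise (P w) (Q w) (column-total P Q w)) ⟩
  ∑ (λ w → column P Q w + 2 * ι (Q w))
    ≡⟨ ∑-distrib-+ (column P Q) (λ w → 2 * ι (Q w)) ⟩
  ∑ (column P Q) + ∑ (λ w → 2 * ι (Q w))
    ≡⟨ cong₂ _+_ (sym (crossing-by-columns P Q)) (∑-scale 2 (λ w → ι (Q w))) ⟩
  crossing P Q + 2 * ones Q ∎
  where
  open ≤-Reasoning
  columnwise : ∀ {c} p q → c + ι (p xor q) ≡ other-side P q → ι (not p) + zeros P * ι q ≤ c + 2 * ι q
  columnwise {c} true  true  e = ≤-trans (≤-reflexive (trans (*-identityʳ (zeros P)) (sym (trans (sym (+-identityʳ c)) e)))) (m≤m+n c 2)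
  columnwise {c} false true  e = ≤-reflexive (begin-equality
    1 + zeros P * 1 ≡⟨ cong suc (trans (*-identityʳ (zeros P)) (sym e)) ⟩
    1 + (c + 1)     ≡⟨ +-comm 1 (c + 1) ⟩
    c + 1 + 1       ≡⟨ +-assoc c 1 1 ⟩
    c + 2 * 1       ∎)
  columnwise {c} true  false e = ≤-trans (≤-reflexive (*-zeroʳ (zeros P))) z≤n
  columnwise {c} false false e = ≤-reflexive (begin-equality
    1 + zeros P * 0 ≡⟨ cong suc (*-zeroʳ (zeros P)) ⟩
    1               ≡⟨ sym single ⟩
    ones P          ≡⟨ sym e ⟩
    c + 2 * 0       ∎)

-- If both sides of P have at least two points, every column is nonempty.
balanced-bound : ∀ {n} (P Q : Fin n → Bool) → 2 ≤ ones P → 2 ≤ zeros P → n ≤ crossing P Q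
balanced-bound {n} P Q two-ones two-zeros =
  subst₂ _≤_ (trans (∑-const n 1) (*-identityʳ n)) (sym (crossing-by-columns P Q)) (∑-mono nonempty)
  where
  two-sides : ∀ t → 2 ≤ other-side P t
  two-sides true  = two-zeros
  two-sides false = two-ones
  nonempty : ∀ w → 1 ≤ column P Q w
  nonempty w = +-cancelʳ-≤ 1 1 (column P Q w)
    (≤-trans (subst (2 ≤_) (sym (column-total P Q w)) (two-sides (Q w)))
             (+-monoʳ-≤ (column P Q w) (ι≤1 (P w xor Q w))))

proper⇒sides : ∀ {n} (P : Fin n → Bool) → Proper P → 1 ≤ ones P × 1 ≤ zeros P
proper⇒sides P ((u , pu) , (w , pw)) =
  subst (λ b → ι b ≤ ones P) pu (term≤∑ (λ v → ι (P v)) u) ,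
  subst (λ b → ι (not b) ≤ zeros P) pw (term≤∑ (λ v → ι (not (P v))) w)

side-sizes : ∀ a b → 1 ≤ a → 1 ≤ b → a ≡ 1 ⊎ b ≡ 1 ⊎ (2 ≤ a × 2 ≤ b)
side-sizes (suc zero)    _             _ _ = inj₁ refl
side-sizes (suc (suc a)) (suc zero)    _ _ = inj₂ (inj₁ refl)
side-sizes (suc (suc a)) (suc (suc b)) _ _ = inj₂ (inj₂ (s≤s (s≤s z≤n) , s≤s (s≤s z≤n)))

single⇒zeros : ∀ {n₁} (P : Fin (suc n₁) → Bool) → ones P ≡ 1 → zeros P ≡ n₁
single⇒zeros P single = suc-injective (trans (cong (_+ zeros P) (sym single)) (ones+zeros P))

single-≥ : ∀ {n₁} (P Q : Fin (suc n₁) → Bool) → 2 ≤ n₁ → ones P ≡ 1 → n₁ ≤ crossing P Q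
single-≥ {n₁} P Q two single = +-cancelʳ-≤ (2 * q) n₁ (crossing P Q) (begin
  n₁ + 2 * q   ≤⟨ +-monoʳ-≤ n₁ (≤-trans (≤-reflexive (*-comm 2 q)) (*-monoʳ-≤ q two)) ⟩
  n₁ + q * n₁  ≡⟨ cong (λ z → z + q * z) (sym (single⇒zeros P single)) ⟩
  zeros P + q * zeros P ≤⟨ single-point-bound P Q single ⟩
  crossing P Q + 2 * q ∎)
  where
  open ≤-Reasoning
  q = ones Q

single-> : ∀ {n₁} (P Q : Fin (suc n₁) → Bool) → 3 ≤ n₁ → ones P ≡ 1 → 1 ≤ ones Q → suc n₁ ≤ crossing P Q
single-> {n₁} P Q three single q≥1 = +-cancelʳ-≤ (2 * q) (suc n₁) (crossing P Q) (begin
  suc n₁ + 2 * q   ≡⟨ +-suc n₁ (2 * q) ⟨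
  n₁ + suc (2 * q) ≤⟨ +-monoʳ-≤ n₁ (begin
                          suc (2 * q)  ≡⟨ +-comm 1 (2 * q) ⟩
                          2 * q + 1    ≤⟨ +-monoʳ-≤ (2 * q) q≥1 ⟩
                          2 * q + q    ≡⟨ +-comm (2 * q) q ⟩
                          3 * q        ≡⟨ *-comm 3 q ⟩
                          q * 3        ≤⟨ *-monoʳ-≤ q three ⟩
                          q * n₁       ∎) ⟩
  n₁ + q * n₁  ≡⟨ cong (λ z → z + q * z) (sym (single⇒zeros P single)) ⟩
  zeros P + q * zeros P ≤⟨ single-point-bound P Q single ⟩
  crossing P Q + 2 * q ∎)
  where
  open ≤-Reasoning
  q = ones Q

crossing-proper : ∀ {n₁} (P Q : Fin (suc n₁) → Bool) → 2 ≤ n₁ → Proper P → n₁ ≤ crossing P Q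
crossing-proper {n₁} P Q two proper with proper⇒sides P proper
... | ones≥1 , zeros≥1 with side-sizes (ones P) (zeros P) ones≥1 zeros≥1
...   | inj₁ single = single-≥ P Q two single
...   | inj₂ (inj₁ single) =
  subst (n₁ ≤_) (sym (crossing-complement P Q)) (single-≥ (complement P) (complement Q) two single)
...   | inj₂ (inj₂ (two-ones , two-zeros)) = ≤-trans (n≤1+n n₁) (balanced-bound P Q two-ones two-zeros)

crossing-proper-proper : ∀ {n₁} (P Q : Fin (suc n₁) → Bool) → 3 ≤ n₁ → Proper P → Proper Q →
                         suc n₁ ≤ crossing P Q
crossing-proper-proper {n₁} P Q three proper proper′ with proper⇒sides P proper | proper⇒sides Q proper′
... | ones≥1 , zeros≥1 | Q-ones≥1 , Q-zeros≥1 with side-sizes (ones P) (zeros P) ones≥1 zeros≥1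
...   | inj₁ single = single-> P Q three single Q-ones≥1
...   | inj₂ (inj₁ single) =
  subst (suc n₁ ≤_) (sym (crossing-complement P Q)) (single-> (complement P) (complement Q) three single Q-zeros≥1)
...   | inj₂ (inj₂ (two-ones , two-zeros)) = balanced-bound P Q two-ones two-zeros

crossing-complete : ∀ n₁ → crossing {suc n₁} (λ _ → true) (λ _ → false) ≡ suc n₁ * n₁
crossing-complete n₁ = +-cancelʳ-≡ n (crossing P Q) (n * n₁) (begin
  crossing P Q + n      ≡⟨ cong (crossing P Q +_) (sym all-ones) ⟩
  crossing P Q + ones P ≡⟨ crossing-to-constant P Q false (λ _ → refl) ⟩
  n * ones P            ≡⟨ cong (n *_) all-ones ⟩
  n * n                 ≡⟨ *-suc n n₁ ⟩
  n + n * n₁            ≡⟨ +-comm n (n * n₁) ⟩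
  n * n₁ + n            ∎)
  where
  open ≡-Reasoning
  n = suc n₁
  P Q : Fin n → Bool
  P _ = true
  Q _ = false
  all-ones : ones P ≡ n
  all-ones = trans (∑-const n 1) (*-identityʳ n)

crossing-constant : ∀ {n₁} (s t : Bool) →
                    crossing {suc n₁} (λ _ → s) (λ _ → t) ≡ ι (s xor t) * (suc n₁ * n₁)
crossing-constant {n₁} s t with s xor t
... | true  = trans (crossing-complete n₁) (sym (+-identityʳ _))
... | false = trans (∑-cong {suc n₁} no-pairs) (∑-zero (suc n₁))
  where
  no-pairs : ∀ u → ∑ (λ w → ι (not (u == w) ∧ false)) ≡ 0
  no-pairs u = trans (∑-cong (λ w → cong ι (∧-zeroʳ (not (u == w))))) (∑-zero (suc n₁))

-- A fibre with no crossing pairs towards a constant fibre is the same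
-- constant (n ≥ 2: every vertex w has a vertex other than itself).
no-crossing⇒constant : ∀ {n₂} (s : Bool) (Q : Fin (suc (suc n₂)) → Bool) →
                       crossing (λ _ → s) Q ≡ 0 → ∀ w → Q w ≡ s
no-crossing⇒constant {n₂} s Q none w with Q w BoolP.≟ s
... | yes same = same
... | no differ = ⊥-elim (0≢1+n (trans (sym vanishes) term))
  where
  pair-term : Fin (suc (suc n₂)) → Fin (suc (suc n₂)) → ℕ
  pair-term u w = ι (not (u == w) ∧ (s xor Q w))
  other : Fin (suc (suc n₂)) → Fin (suc (suc n₂))
  other zero    = suc zero
  other (suc _) = zero
  other≢ : ∀ w → ¬ other w ≡ w
  other≢ zero    ()
  other≢ (suc _) ()
  distinct-xor : ∀ s t → ¬ t ≡ s → (s xor t) ≡ true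
  distinct-xor true  true  ne = ⊥-elim (ne refl)
  distinct-xor true  false _  = refl
  distinct-xor false true  _  = refl
  distinct-xor false false ne = ⊥-elim (ne refl)
  vanishes : pair-term (other w) w ≡ 0
  vanishes = ∑≡0⇒ (pair-term (other w)) (∑≡0⇒ (λ u → ∑ (pair-term u)) none (other w)) w
  term : pair-term (other w) w ≡ 1
  term rewrite ==-false (other≢ w) | distinct-xor s (Q w) differ = refl

all-or-exists : ∀ {m} {A B : Fin m → Set} → (∀ x → A x ⊎ B x) → (∀ x → A x) ⊎ ∃ B
all-or-exists {zero}  d = inj₁ (λ ())
all-or-exists {suc m} d with d zero | all-or-exists (λ x → d (suc x))
... | inj₂ b | _            = inj₂ (zero , b)
... | inj₁ a | inj₁ as      = inj₁ λ { zero → a ; (suc x) → as x }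
... | inj₁ _ | inj₂ (x , b) = inj₂ (suc x , b)

constant-or-proper : ∀ {k} (P : Fin (suc k) → Bool) → (∀ u → P u ≡ P zero) ⊎ Proper P
constant-or-proper P with findTrue (λ u → P u xor P zero)
... | inj₂ none = inj₁ (λ u → xor-agree (none u))
... | inj₁ (u , differ) with P zero in e
...   | true  = inj₂ ((zero , e) , (u , xor-disagree differ))
...   | false = inj₂ ((u , xor-disagree differ) , (zero , e))

fibre : ∀ {m n} → (Fin (m * n) → Bool) → Fin m → Fin n → Bool
fibre {m} {n} S x u = S (combine {m} {n} x u)

fibre-of : ∀ {m n} (S : Fin (m * n) → Bool) i →
           S i ≡ fibre {m} {n} S (proj₁ (remQuot {m} n i)) (proj₂ (remQuot {m} n i))
fibre-of {m} {n} S i = cong S (sym (FinP.combine-remQuot {m} n i))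

adj-⊗K : ∀ {m n} (G : Graph m) x u y w →
         adj (G ⊗ K n) (combine x u) (combine y w) ≡ (adj G x y ∧ not (u == w))
adj-⊗K {m} {n} G x u y w =
  cong₂ (λ p q → adj G (proj₁ p) (proj₁ q) ∧ not (proj₂ p == proj₂ q))
        (FinP.remQuot-combine {m} {n} x u) (FinP.remQuot-combine {m} {n} y w)

contribution : ∀ {m n} (G : Graph m) → (Fin (m * n) → Bool) → Fin m → Fin m → ℕ
contribution {m} {n} G S x y = ι (adj G x y) * crossing (fibre {m} {n} S x) (fibre {m} {n} S y)

∂-⊗K : ∀ {m n} (G : Graph m) (S : Fin (m * n) → Bool) →
       ∂ (G ⊗ K n) S ≡ ∑ (λ x → ∑ (λ y → contribution {m} {n} G S x y))
∂-⊗K {m} {n} G S = begin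
  ∑ (λ i → ∑ (λ j → ι (M i j)))
    ≡⟨ ∑-combine m n (λ i → ∑ (λ j → ι (M i j))) ⟩
  ∑ (λ x → ∑ (λ u → ∑ (λ j → ι (M (v x u) j))))
    ≡⟨ ∑-cong {m} (λ x → ∑-cong {n} (λ u → ∑-combine m n (λ j → ι (M (v x u) j)))) ⟩
  ∑ (λ x → ∑ (λ u → ∑ (λ y → ∑ (λ w → ι (M (v x u) (v y w))))))
    ≡⟨ ∑-cong {m} (λ x → ∑-cong {n} (λ u → ∑-cong {m} (λ y → ∑-cong {n} (λ w → edge x u y w)))) ⟩
  ∑ (λ x → ∑ (λ u → ∑ (λ y → ∑ (λ w → ι (adj G x y) * pair x u y w))))
    ≡⟨ ∑-cong {m} (λ x → ∑-comm {n} {m} (λ u y → ∑ (λ w → ι (adj G x y) * pair x u y w))) ⟩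
  ∑ (λ x → ∑ (λ y → ∑ (λ u → ∑ (λ w → ι (adj G x y) * pair x u y w))))
    ≡⟨ ∑-cong {m} (λ x → ∑-cong {m} (λ y → scale x y)) ⟩
  ∑ (λ x → ∑ (λ y → contribution {m} {n} G S x y)) ∎
  where
  open ≡-Reasoning
  v : Fin m → Fin n → Fin (m * n)
  v = combine
  M : Fin (m * n) → Fin (m * n) → Bool
  M = mem (boundary (G ⊗ K n) S)
  pair : Fin m → Fin n → Fin m → Fin n → ℕ
  pair x u y w = ι (not (u == w) ∧ (fibre {m} {n} S x u xor fibre {m} {n} S y w))
  edge : ∀ x u y w → ι (M (v x u) (v y w)) ≡ ι (adj G x y) * pair x u y w
  edge x u y w rewrite adj-⊗K {m} {n} G x u y w =
    trans (cong ι (∧-assoc (adj G x y) (not (u == w)) _)) (ι-∧ (adj G x y) _)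
  scale : ∀ x y → ∑ (λ u → ∑ (λ w → ι (adj G x y) * pair x u y w)) ≡ contribution {m} {n} G S x y
  scale x y = trans (∑-cong {n} (λ u → ∑-scale (ι (adj G x y)) (pair x u y)))
                    (∑-scale (ι (adj G x y)) (λ u → ∑ (pair x u y)))

-- From here on G has m + 1 vertices and n = n₁ + 1 ≥ 3; H = G × K_n.
module Product {m n₃ : ℕ} (G : Graph (suc m)) where
  n₁ n : ℕ
  n₁ = suc (suc n₃)
  n  = suc n₁

  H : Graph (suc m * n)
  H = G ⊗ K n

  A : (Fin (suc m * n) → Bool) → Fin (suc m) → Fin n → Bool
  A = fibre {suc m} {n}

  C : (Fin (suc m * n) → Bool) → Fin (suc m) → Fin (suc m) → ℕ
  C = contribution {suc m} {n} G

  C-edge : ∀ S {x y} → adj G x y ≡ true → C S x y ≡ crossing (A S x) (A S y)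
  C-edge S {x} {y} e = trans (cong (λ b → ι b * crossing (A S x) (A S y)) e) (+-identityʳ _)

  C-non-edge : ∀ S {x y} → adj G x y ≡ false → C S x y ≡ 0
  C-non-edge S {x} {y} e = cong (λ b → ι b * crossing (A S x) (A S y)) e

  ∂-lift : ∀ S (T : Fin (suc m) → Bool) → (∀ x u → A S x u ≡ T x) → ∂ H S ≡ (n * n₁) * ∂ G T
  ∂-lift S T const = begin
    ∂ H S                                                          ≡⟨ ∂-⊗K G S ⟩
    ∑ (λ x → ∑ (λ y → C S x y))                                    ≡⟨ ∑-cong (λ x → ∑-cong (λ y → lifted x y)) ⟩
    ∑ (λ x → ∑ (λ y → (n * n₁) * ι (adj G x y ∧ (T x xor T y))))    ≡⟨ ∑-cong (λ x → ∑-scale (n * n₁) (edge x)) ⟩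
    ∑ (λ x → (n * n₁) * ∑ (edge x))                                ≡⟨ ∑-scale (n * n₁) (λ x → ∑ (edge x)) ⟩
    (n * n₁) * ∂ G T                                               ∎
    where
    open ≡-Reasoning
    edge : Fin (suc m) → Fin (suc m) → ℕ
    edge x y = ι (adj G x y ∧ (T x xor T y))
    lifted : ∀ x y → C S x y ≡ (n * n₁) * ι (adj G x y ∧ (T x xor T y))
    lifted x y = begin
      ι (adj G x y) * crossing (A S x) (A S y)
        ≡⟨ cong (ι (adj G x y) *_) (trans (crossing-cong (const x) (const y)) (crossing-constant {n₁} (T x) (T y))) ⟩
      ι (adj G x y) * (ι (T x xor T y) * (n * n₁))
        ≡⟨ rearrange (ι (adj G x y)) (ι (T x xor T y)) (n * n₁) ⟩
      (n * n₁) * (ι (adj G x y) * ι (T x xor T y))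
        ≡⟨ cong ((n * n₁) *_) (sym (ι-∧ (adj G x y) (T x xor T y))) ⟩
      (n * n₁) * ι (adj G x y ∧ (T x xor T y)) ∎
      where
      rearrange : ∀ a b c → a * (b * c) ≡ c * (a * b)
      rearrange = solve-∀

  data Shape (S : Fin (suc m * n) → Bool) : Set where
    lifted : (T : Fin (suc m) → Bool) → Proper T → (∀ x u → A S x u ≡ T x) → Shape S
    split  : (x₀ : Fin (suc m)) → Proper (A S x₀) → Shape S

  shape : ∀ S → Proper S → Shape S
  shape S ((a , sa) , (b , sb)) with all-or-exists (λ x → constant-or-proper (A S x))
  ... | inj₂ (x₀ , proper) = split x₀ proper
  ... | inj₁ const = lifted T ((proj₁ (coords a) , side a sa) , (proj₁ (coords b) , side b sb)) (λ x u → const x u)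
    where
    T : Fin (suc m) → Bool
    T x = A S x zero
    coords : Fin (suc m * n) → Fin (suc m) × Fin n
    coords i = remQuot {suc m} n i
    side : ∀ i {s} → S i ≡ s → T (proj₁ (coords i)) ≡ s
    side i e = trans (sym (const (proj₁ (coords i)) (proj₂ (coords i)))) (trans (sym (fibre-of {suc m} {n} S i)) e)

  data Position (x₀ x y : Fin (suc m)) : Set where
    non-edge : adj G x y ≡ false → Position x₀ x y
    from-x₀  : x ≡ x₀ → adj G x₀ y ≡ true → ¬ y ≡ x₀ → Position x₀ x y
    to-x₀    : y ≡ x₀ → adj G x x₀ ≡ true → ¬ x ≡ x₀ → Position x₀ x y
    away     : ¬ x ≡ x₀ → ¬ y ≡ x₀ → adj G x y ≡ true → Position x₀ x y

  position : ∀ x₀ x y → Position x₀ x y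
  position x₀ x y with adj G x y in e | x FinP.≟ x₀ | y FinP.≟ x₀
  ... | false | _        | _        = non-edge e
  ... | true  | yes refl | yes refl = ⊥-elim (adjacent⇒distinct G e refl)
  ... | true  | yes refl | no y≢x₀  = from-x₀ refl e y≢x₀
  ... | true  | no x≢x₀  | yes refl = to-x₀ refl e x≢x₀
  ... | true  | no x≢x₀  | no y≢x₀  = away x≢x₀ y≢x₀ e

  -- The star of x₀: every edge of G at x₀, weighted n − 1 in both orders.
  weight : Bool → Bool → Bool → ℕ
  weight a b c = ι a * (n₁ * ι c) + ι b * (n₁ * ι c)

  star : Fin (suc m) → Fin (suc m) → Fin (suc m) → ℕ
  star x₀ x y = weight (x == x₀) (y == x₀) (adj G x y)

  star-total : ∀ x₀ → ∑ (λ x → ∑ (λ y → star x₀ x y)) ≡ 2 * (n₁ * degree G x₀)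
  star-total x₀ = begin
    ∑ (λ x → ∑ (λ y → star x₀ x y))
      ≡⟨ ∑-cong (λ x → ∑-distrib-+ (outgoing x) (incoming x)) ⟩
    ∑ (λ x → ∑ (outgoing x) + ∑ (incoming x))
      ≡⟨ ∑-distrib-+ (λ x → ∑ (outgoing x)) (λ x → ∑ (incoming x)) ⟩
    ∑ (λ x → ∑ (outgoing x)) + ∑ (λ x → ∑ (incoming x))
      ≡⟨ cong₂ _+_ outgoing-total incoming-total ⟩
    n₁ * degree G x₀ + n₁ * degree G x₀
      ≡⟨ cong (n₁ * degree G x₀ +_) (sym (+-identityʳ _)) ⟩
    2 * (n₁ * degree G x₀) ∎
    where
    open ≡-Reasoning
    outgoing incoming : Fin (suc m) → Fin (suc m) → ℕ
    outgoing x y = ι (x == x₀) * (n₁ * ι (adj G x y))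
    incoming x y = ι (y == x₀) * (n₁ * ι (adj G x y))
    outgoing-total : ∑ (λ x → ∑ (outgoing x)) ≡ n₁ * degree G x₀
    outgoing-total = begin
      ∑ (λ x → ∑ (outgoing x))                          ≡⟨ ∑-cong (λ x → ∑-scale (ι (x == x₀)) (λ y → n₁ * ι (adj G x y))) ⟩
      ∑ (λ x → ι (x == x₀) * ∑ (λ y → n₁ * ι (adj G x y))) ≡⟨ ∑-delta x₀ (λ x → ∑ (λ y → n₁ * ι (adj G x y))) ⟩
      ∑ (λ y → n₁ * ι (adj G x₀ y))                     ≡⟨ ∑-scale n₁ (λ y → ι (adj G x₀ y)) ⟩
      n₁ * ∑ (λ y → ι (adj G x₀ y))                     ≡⟨ cong (n₁ *_) (sym (degree-as-∑ G x₀)) ⟩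
      n₁ * degree G x₀                                  ∎
    incoming-total : ∑ (λ x → ∑ (incoming x)) ≡ n₁ * degree G x₀
    incoming-total = begin
      ∑ (λ x → ∑ (incoming x))          ≡⟨ ∑-cong (λ x → ∑-delta x₀ (λ y → n₁ * ι (adj G x y))) ⟩
      ∑ (λ x → n₁ * ι (adj G x x₀))     ≡⟨ ∑-scale n₁ (λ x → ι (adj G x x₀)) ⟩
      n₁ * ∑ (λ x → ι (adj G x x₀))     ≡⟨ cong (n₁ *_) (∑-cong (λ x → cong ι (adjSym G x x₀))) ⟩
      n₁ * ∑ (λ y → ι (adj G x₀ y))     ≡⟨ cong (n₁ *_) (sym (degree-as-∑ G x₀)) ⟩
      n₁ * degree G x₀                  ∎

  star-non-edge : ∀ {x₀ x y} → adj G x y ≡ false → star x₀ x y ≡ 0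
  star-non-edge {x₀} {x} {y} e = trans (cong (weight (x == x₀) (y == x₀)) e) (no-edge (x == x₀) (y == x₀))
    where
    no-edge : ∀ a b → weight a b false ≡ 0
    no-edge a b = cong₂ _+_ (trans (cong (ι a *_) (*-zeroʳ n₁)) (*-zeroʳ (ι a)))
                            (trans (cong (ι b *_) (*-zeroʳ n₁)) (*-zeroʳ (ι b)))

  star-from : ∀ {x₀ y} → adj G x₀ y ≡ true → ¬ y ≡ x₀ → star x₀ x₀ y ≡ n₁
  star-from {x₀} {y} e y≢x₀ =
    trans (cong₂ (weight (x₀ == x₀)) (==-false y≢x₀) e)
          (trans (cong (λ a → weight a false true) (==-refl x₀))
                 (trans (+-identityʳ _) (trans (+-identityʳ _) (*-identityʳ n₁))))

  star-to : ∀ {x₀ x} → adj G x x₀ ≡ true → ¬ x ≡ x₀ → star x₀ x x₀ ≡ n₁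
  star-to {x₀} {x} e x≢x₀ =
    trans (cong₂ (λ a c → weight a (x₀ == x₀) c) (==-false x≢x₀) e)
          (trans (cong (λ b → weight false b true) (==-refl x₀))
                 (trans (+-identityʳ _) (*-identityʳ n₁)))

  star-away : ∀ {x₀ x y} → ¬ x ≡ x₀ → ¬ y ≡ x₀ → star x₀ x y ≡ 0
  star-away {x₀} {x} {y} x≢x₀ y≢x₀ = cong₂ (λ a b → weight a b (adj G x y)) (==-false x≢x₀) (==-false y≢x₀)

  -- A proper fibre at x₀ meets at least n − 1 crossing pairs on every edge
  -- at x₀, so the boundary is at least 2(n − 1) deg x₀.
  star≤C : ∀ S x₀ → Proper (A S x₀) → ∀ x y → star x₀ x y ≤ C S x y
  star≤C S x₀ proper x y with position x₀ x y
  ... | non-edge e        = ≤-trans (≤-reflexive (star-non-edge e)) z≤n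
  ... | from-x₀ refl e ne = subst₂ _≤_ (sym (star-from e ne)) (sym (C-edge S e))
                              (crossing-proper (A S x₀) (A S y) (s≤s (s≤s z≤n)) proper)
  ... | to-x₀ refl e ne   = subst₂ _≤_ (sym (star-to e ne)) (sym (trans (C-edge S e) (crossing-sym (A S x) (A S x₀))))
                              (crossing-proper (A S x₀) (A S x) (s≤s (s≤s z≤n)) proper)
  ... | away ne ne′ _     = ≤-trans (≤-reflexive (star-away ne ne′)) z≤n

  split-bound : ∀ S x₀ → Proper (A S x₀) → 2 * (n₁ * degree G x₀) ≤ ∂ H S
  split-bound S x₀ proper =
    subst₂ _≤_ (star-total x₀) (sym (∂-⊗K G S)) (∑-mono (λ x → ∑-mono (star≤C S x₀ proper x)))

  single : Fin (suc m) → Fin (suc m * n) → Bool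
  single x₀ i = i == combine x₀ zero

  single-fibre : ∀ x₀ x u → A (single x₀) x u ≡ (x == x₀ ∧ u == zero)
  single-fibre x₀ x u = combine-== x x₀ u zero

  ∂-single : ∀ x₀ → ∂ H (single x₀) ≡ 2 * (n₁ * degree G x₀)
  ∂-single x₀ = trans (∂-⊗K G (single x₀)) (trans (∑-cong (λ x → ∑-cong (λ y → C≡star x y))) (star-total x₀))
    where
    at-x₀ : ∀ u → A (single x₀) x₀ u ≡ (u == zero)
    at-x₀ u = trans (single-fibre x₀ x₀ u) (cong (_∧ (u == zero)) (==-refl x₀))
    off-x₀ : ∀ {x} → ¬ x ≡ x₀ → ∀ u → A (single x₀) x u ≡ false
    off-x₀ x≢x₀ u = trans (single-fibre x₀ _ u) (cong (_∧ (u == zero)) (==-false x≢x₀))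
    one-point : ones (A (single x₀) x₀) ≡ 1
    one-point = trans (∑-cong (λ u → cong ι (at-x₀ u))) (count-point (zero {n₁}))
    to-empty : ∀ {y} → ¬ y ≡ x₀ → crossing (A (single x₀) x₀) (A (single x₀) y) ≡ n₁
    to-empty {y} y≢x₀ = +-cancelʳ-≡ 1 (crossing P Q) n₁ (begin
      crossing P Q + 1      ≡⟨ cong (crossing P Q +_) (sym one-point) ⟩
      crossing P Q + ones P ≡⟨ crossing-to-constant P Q false (off-x₀ y≢x₀) ⟩
      n * ones P            ≡⟨ cong (n *_) one-point ⟩
      n * 1                 ≡⟨ *-identityʳ n ⟩
      n                     ≡⟨ +-comm 1 n₁ ⟩
      n₁ + 1                ∎)
      where
      open ≡-Reasoning
      P Q : Fin n → Bool
      P = A (single x₀) x₀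
      Q = A (single x₀) y
    C≡star : ∀ x y → C (single x₀) x y ≡ star x₀ x y
    C≡star x y with position x₀ x y
    ... | non-edge e        = trans (C-non-edge (single x₀) e) (sym (star-non-edge e))
    ... | from-x₀ refl e ne = trans (C-edge (single x₀) e) (trans (to-empty ne) (sym (star-from e ne)))
    ... | to-x₀ refl e ne   = trans (C-edge (single x₀) e)
                                (trans (crossing-sym (A (single x₀) x) (A (single x₀) x₀))
                                       (trans (to-empty ne) (sym (star-to e ne))))
    ... | away ne ne′ e     = trans (C-edge (single x₀) e)
                                (trans (crossing-cong (off-x₀ ne) (off-x₀ ne′))
                                       (trans (crossing-constant {n₁} false false) (sym (star-away ne ne′))))

  VertexLike : (Fin (suc m * n) → Bool) → Set
  VertexLike S = ∃ λ v → ∀ i j → (S i xor S j) ≡ ((i == v) xor (j == v))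

  not-both-single : ∀ (P : Fin n → Bool) t → other-side P t ≡ 1 → other-side P (not t) ≡ 1 → ⊥
  not-both-single P t p q with trans (sym (ones+zeros P)) (sides t p q)
    where
    sides : ∀ t → other-side P t ≡ 1 → other-side P (not t) ≡ 1 → ones P + zeros P ≡ 2
    sides true  p q = cong₂ _+_ q p
    sides false p q = cong₂ _+_ p q
  ... | ()

  -- Let S have a proper fibre at x₀ and a boundary no larger
  -- than 2(n − 1) δ(G), the boundary of a single vertex over a vertex of
  -- minimum degree.  Then split-bound is an equality: x₀ has minimum degree,
  -- the edges away from x₀ carry no crossing pairs and those at x₀ exactly
  -- n − 1.  Consequently S cuts off a single vertex of H, or n = 3 and G = K₂.
  module Tight (conn : Connected G) (degree≥1 : ∀ x → 1 ≤ degree G x)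
               (S : Fin (suc m * n) → Bool) (x₀ : Fin (suc m)) (proper : Proper (A S x₀))
               (tight : ∂ H S ≤ 2 * (n₁ * δ G)) where

    C≡star : ∀ x y → C S x y ≡ star x₀ x y
    C≡star x y = sym (∑∑-tight (star≤C S x₀ proper) (begin
      ∑ (λ x → ∑ (C S x))                     ≡⟨ ∂-⊗K G S ⟨
      ∂ H S                                   ≤⟨ tight ⟩
      2 * (n₁ * δ G)                          ≤⟨ *-monoʳ-≤ 2 (*-monoʳ-≤ n₁ (δ≤degree G x₀)) ⟩
      2 * (n₁ * degree G x₀)                  ≡⟨ star-total x₀ ⟨
      ∑ (λ x → ∑ (star x₀ x))                 ∎) x y)
      where open ≤-Reasoning

    minimum-degree : degree G x₀ ≤ δ G
    minimum-degree = *-cancelˡ-≤ n₁ (*-cancelˡ-≤ 2 (≤-trans (split-bound S x₀ proper) tight))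

    away-crossing : ∀ {x y} → ¬ x ≡ x₀ → ¬ y ≡ x₀ → adj G x y ≡ true → crossing (A S x) (A S y) ≡ 0
    away-crossing {x} {y} x≢x₀ y≢x₀ e = trans (sym (C-edge S e)) (trans (C≡star x y) (star-away x≢x₀ y≢x₀))

    at-x₀-crossing : ∀ {y} → adj G x₀ y ≡ true → crossing (A S x₀) (A S y) ≡ n₁
    at-x₀-crossing {y} e = trans (sym (C-edge S e))
      (trans (C≡star x₀ y) (star-from e (λ y≡x₀ → adjacent⇒distinct G e (sym y≡x₀))))

    constant-neighbour : ∀ {y} t → adj G x₀ y ≡ true → (∀ u → A S y u ≡ t) → other-side (A S x₀) t ≡ 1
    constant-neighbour {y} t e const = sym (*-cancelˡ-≡ 1 s n₁ (+-cancelˡ-≡ s (n₁ * 1) (n₁ * s) (begin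
      s + n₁ * 1                          ≡⟨ cong (s +_) (*-identityʳ n₁) ⟩
      s + n₁                              ≡⟨ +-comm s n₁ ⟩
      n₁ + s                              ≡⟨ cong (_+ s) (at-x₀-crossing e) ⟨
      crossing (A S x₀) (A S y) + s       ≡⟨ crossing-to-constant (A S x₀) (A S y) t const ⟩
      n * s                               ∎)))
      where
      open ≡-Reasoning
      s = other-side (A S x₀) t

    -- Constant fibres propagate along the edges away from x₀, which carry no
    -- crossing pairs.
    spread : ∀ t → (∀ y → adj G x₀ y ≡ true → ∀ u → A S y u ≡ t) → ∀ z → z ≡ x₀ ⊎ (∀ u → A S z u ≡ t)
    spread t near z = reach-invariant (λ w → w ≡ x₀ ⊎ (∀ u → A S w u ≡ t)) extend (inj₁ refl) (conn x₀ z)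
      where
      extend : ∀ w z → w ≡ x₀ ⊎ (∀ u → A S w u ≡ t) → adj G w z ≡ true → z ≡ x₀ ⊎ (∀ u → A S z u ≡ t)
      extend w z (inj₁ refl) e = inj₂ (near z e)
      extend w z (inj₂ const) e with z FinP.≟ x₀ | w FinP.≟ x₀
      ... | yes z≡x₀ | _        = inj₁ z≡x₀
      ... | no _     | yes refl = inj₂ (near z e)
      ... | no z≢x₀  | no w≢x₀  = inj₂ (no-crossing⇒constant t (A S z)
                                    (trans (crossing-cong {Q = A S z} (λ u → sym (const u)) (λ _ → refl)) (away-crossing w≢x₀ z≢x₀ e)))

    -- All fibres but the one at x₀ are constant t, and that one has a single
    -- point on the side not t: S is a single vertex or its complement.
    vertex-like : ∀ t → other-side (A S x₀) t ≡ 1 → (∀ z → z ≡ x₀ ⊎ (∀ u → A S z u ≡ t)) → VertexLike S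
    vertex-like t one-off rest with single-point (λ u → A S x₀ u xor t) (trans (side-count (A S x₀) t) one-off)
    ... | u₀ , at-u₀ = v , λ i j → trans (sym (xor-cancel (S i) (S j) t)) (cong₂ _xor_ (shifted i) (shifted j))
      where
      v : Fin (suc m * n)
      v = combine x₀ u₀
      xor-cancel : ∀ a b t → ((a xor t) xor (b xor t)) ≡ (a xor b)
      xor-cancel a b true  = trans (cong₂ _xor_ (xor-true a) (xor-true b)) (not-xor-not a b)
        where
        not-xor-not : ∀ a b → (not a xor not b) ≡ (a xor b)
        not-xor-not true  b = refl
        not-xor-not false b = not-involutive b
      xor-cancel a b false = cong₂ _xor_ (xor-false a) (xor-false b)
      on-pair : ∀ x u → (A S x u xor t) ≡ (combine {suc m} {n} x u == v)
      on-pair x u with x FinP.≟ x₀ | rest x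
      ... | yes refl | _          = trans (at-u₀ u) (sym (trans (combine-== x₀ x₀ u u₀) (cong (_∧ (u == u₀)) (==-refl x₀))))
      ... | no x≢x₀  | inj₁ x≡x₀  = ⊥-elim (x≢x₀ x≡x₀)
      ... | no x≢x₀  | inj₂ const = trans (cong (_xor t) (const u))
                          (trans (xor-self t) (sym (trans (combine-== x x₀ u u₀) (cong (_∧ (u == u₀)) (==-false x≢x₀)))))
        where
        xor-self : ∀ t → (t xor t) ≡ false
        xor-self true  = refl
        xor-self false = refl
      shifted : ∀ i → (S i xor t) ≡ (i == v)
      shifted i = trans (cong (_xor t) (fibre-of {suc m} {n} S i))
                        (trans (on-pair (proj₁ (remQuot {suc m} n i)) (proj₂ (remQuot {suc m} n i)))
                               (cong (_== v) (FinP.combine-remQuot {suc m} n i)))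

    -- A neighbour y of x₀ with a proper fibre forces n = 3 (for n ≥ 4 the
    -- crossing count would exceed n − 1), and then y has no neighbour but
    -- x₀, so x₀ (of minimum degree) has no neighbour but y and G = K₂.
    proper-neighbour⇒K₂ : ∀ {y} → adj G x₀ y ≡ true → Proper (A S y) → Iso G (K 2) × n₁ ≡ 2
    proper-neighbour⇒K₂ {y} e proper-y = K₂ n₃ refl
      where
      y≢x₀ : ¬ y ≡ x₀
      y≢x₀ y≡x₀ = adjacent⇒distinct G e (sym y≡x₀)
      only-x₀ : ∀ z → adj G y z ≡ true → z ≡ x₀
      only-x₀ z e′ with z FinP.≟ x₀
      ... | yes z≡x₀ = z≡x₀
      ... | no z≢x₀  = ⊥-elim (no-room (subst (n₁ ≤_) (away-crossing y≢x₀ z≢x₀ e′)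
                                       (crossing-proper (A S y) (A S z) (s≤s (s≤s z≤n)) proper-y)))
        where
        no-room : ¬ n₁ ≤ 0
        no-room ()
      K₂ : ∀ k → n₃ ≡ k → Iso G (K 2) × n₁ ≡ 2
      K₂ (suc k) refl = ⊥-elim (<-irrefl (sym (at-x₀-crossing e))
                          (crossing-proper-proper (A S x₀) (A S y) (s≤s (s≤s (s≤s z≤n))) proper proper-y))
      K₂ zero refl = two-vertices⇒K₂ G x₀ y e cover , refl
        where
        degree-y : degree G y ≤ 1
        degree-y = subst (_≤ 1) (sym (degree-as-∑ G y))
          (≤-trans (∑-mono (λ z → ι-mono (λ e′ → subst (λ w → (w == x₀) ≡ true) (sym (only-x₀ z e′)) (==-refl x₀))))
                   (≤-reflexive (count-point x₀)))
        only-y : ∀ z → adj G x₀ z ≡ true → z ≡ y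
        only-y z e′ with z FinP.≟ y
        ... | yes z≡y = z≡y
        ... | no z≢y  = ⊥-elim (<⇒≱ (subst (2 ≤_) (sym (degree-as-∑ G x₀))
                                       (two-terms (λ w → ι (adj G x₀ w)) z y z≢y
                                         (≤-reflexive (cong ι (sym e′))) (≤-reflexive (cong ι (sym e)))))
                                     (≤-trans minimum-degree (≤-trans (δ≤degree G y) degree-y)))
        cover : ∀ w → w ≡ x₀ ⊎ w ≡ y
        cover w = reach-invariant (λ w → w ≡ x₀ ⊎ w ≡ y) along-edge (inj₁ refl) (conn x₀ w)
          where
          along-edge : ∀ a b → a ≡ x₀ ⊎ a ≡ y → adj G a b ≡ true → b ≡ x₀ ⊎ b ≡ y
          along-edge a b (inj₁ refl) e′ = inj₂ (only-y b e′)
          along-edge a b (inj₂ refl) e′ = inj₁ (only-x₀ b e′)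

    outcome : VertexLike S ⊎ (Iso G (K 2) × n₁ ≡ 2)
    outcome with all-or-exists neighbour-shape
      where
      neighbour-shape : ∀ y → (adj G x₀ y ≡ true → ∀ u → A S y u ≡ A S y zero) ⊎ (adj G x₀ y ≡ true × Proper (A S y))
      neighbour-shape y with adj G x₀ y | constant-or-proper (A S y)
      ... | false | _            = inj₁ (λ ())
      ... | true  | inj₁ const   = inj₁ (λ _ → const)
      ... | true  | inj₂ proper′ = inj₂ (refl , proper′)
    ... | inj₂ (y , e , proper-y) = inj₂ (proper-neighbour⇒K₂ e proper-y)
    ... | inj₁ constant = inj₁ (vertex-like t one-off (spread t agree))
      where
      y₀ : Fin (suc m)
      y₀ = proj₁ (degree≥1⇒neighbour G x₀ (degree≥1 x₀))
      e₀ : adj G x₀ y₀ ≡ true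
      e₀ = proj₂ (degree≥1⇒neighbour G x₀ (degree≥1 x₀))
      t : Bool
      t = A S y₀ zero
      one-off : other-side (A S x₀) t ≡ 1
      one-off = constant-neighbour t e₀ (constant y₀ e₀)
      agree : ∀ y → adj G x₀ y ≡ true → ∀ u → A S y u ≡ t
      agree y e u with A S y zero BoolP.≟ t
      ... | yes same = trans (constant y e u) same
      ... | no differ = ⊥-elim (not-both-single (A S x₀) t one-off
                          (subst (λ s → other-side (A S x₀) s ≡ 1) (BoolP.¬-not differ)
                                 (constant-neighbour (A S y zero) e (constant y e))))

  -- Let F be a minimum cut of G, the boundary of T₀.  If
  -- n κ'(G) ≤ δ(G), every proper bipartition of H has boundary at least
  -- n(n − 1) · 2κ'(G), the boundary of the lift S₀ of T₀; so the boundary of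
  -- S₀ is a minimum cut of H, but it is not the set of edges at one vertex,
  -- and when κ'(G) = 0 it disconnects H.
  module Forward (F : EdgeSet G) (minF : IsMinEdgeCut G F) (T₀ : Fin (suc m) → Bool) (proper-T₀ : Proper T₀)
                 (F≡∂T₀ : ∀ i j → mem F i j ≡ mem (boundary G T₀) i j) (small : n * size F ≤ δ G) where
    k : ℕ
    k = size F

    lower-bound : ∀ S → Proper S → (n * n₁) * (2 * k) ≤ ∂ H S
    lower-bound S proper with shape S proper
    ... | lifted T proper-T const =
      subst ((n * n₁) * (2 * k) ≤_) (sym (∂-lift S T const)) (*-monoʳ-≤ (n * n₁) (minCut-≤-∂ G F minF T proper-T))
    ... | split x₀ proper-x₀ = begin
      (n * n₁) * (2 * k)     ≡⟨ rearrange n n₁ k ⟩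
      2 * (n₁ * (n * k))     ≤⟨ *-monoʳ-≤ 2 (*-monoʳ-≤ n₁ (≤-trans small (δ≤degree G x₀))) ⟩
      2 * (n₁ * degree G x₀) ≤⟨ split-bound S x₀ proper-x₀ ⟩
      ∂ H S                  ∎
      where
      open ≤-Reasoning
      rearrange : ∀ n n₁ k → (n * n₁) * (2 * k) ≡ 2 * (n₁ * (n * k))
      rearrange = solve-∀

    S₀ : Fin (suc m * n) → Bool
    S₀ i = T₀ (proj₁ (remQuot {suc m} n i))

    S₀-fibre : ∀ x u → A S₀ x u ≡ T₀ x
    S₀-fibre x u = cong (λ p → T₀ (proj₁ p)) (FinP.remQuot-combine {suc m} {n} x u)

    S₀-proper : Proper S₀
    S₀-proper = lift-side proper-T₀
      where
      lift-side : Proper T₀ → Proper S₀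
      lift-side ((a , ta) , (b , tb)) = (combine a zero , trans (S₀-fibre a zero) ta) , (combine b zero , trans (S₀-fibre b zero) tb)

    ∂S₀ : ∂ H S₀ ≡ (n * n₁) * (2 * k)
    ∂S₀ = trans (∂-lift S₀ T₀ S₀-fibre) (cong ((n * n₁) *_) (trans (sym (pairs-cong F≡∂T₀)) (pairs-size F)))

    S₀-minimum : IsMinEdgeCut H (boundary H S₀)
    S₀-minimum = least-boundary⇒minCut H S₀ S₀-proper (λ S proper → subst (_≤ ∂ H S) (sym ∂S₀) (lower-bound S proper))

    ∂T₀ : ∂ G T₀ ≡ 2 * k
    ∂T₀ = trans (sym (pairs-cong F≡∂T₀)) (pairs-size F)

    ∂T₀-positive : 0 < k → 0 < ∂ G T₀
    ∂T₀-positive k>0 = subst (0 <_) (sym ∂T₀) (*-monoʳ-< 2 k>0)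

    -- An edge pq of G crossing T₀ lifts to the crossing edges (p,0)(q,1) and
    -- (p,2)(q,0) of H, which have no common end.
    not-vertex-cut : 0 < k → ¬ IsTrivialCut H (boundary H S₀)
    not-vertex-cut k>0 (v , at-v) = from-edge (crossing-edge G T₀ (∂T₀-positive k>0))
      where
      from-edge : (∃ λ p → ∃ λ q → T₀ p ≡ true × T₀ q ≡ false × adj G p q ≡ true) → ⊥
      from-edge (p , q , tp , tq , pq) = no-common-end (ends (λ ())) (ends (λ ()))
        where
        lifted-edge : ∀ {u w} → ¬ u ≡ w → mem (boundary H S₀) (combine p u) (combine q w) ≡ true
        lifted-edge {u} {w} u≢w = begin
          adj H (combine p u) (combine q w) ∧ (S₀ (combine p u) xor S₀ (combine q w))
            ≡⟨ cong₂ _∧_ (adj-⊗K G p u q w) (cong₂ _xor_ (S₀-fibre p u) (S₀-fibre q w)) ⟩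
          (adj G p q ∧ not (u == w)) ∧ (T₀ p xor T₀ q)
            ≡⟨ cong₂ (λ a b → (a ∧ not b) ∧ (T₀ p xor T₀ q)) pq (==-false u≢w) ⟩
          T₀ p xor T₀ q
            ≡⟨ cong₂ _xor_ tp tq ⟩
          true ∎
          where open ≡-Reasoning
        either : ∀ {a b} → (a ∨ b) ≡ true → a ≡ true ⊎ b ≡ true
        either {true}  _ = inj₁ refl
        either {false} e = inj₂ e
        ends : ∀ {u w} → ¬ u ≡ w → (combine p u == v) ≡ true ⊎ (combine q w == v) ≡ true
        ends {u} {w} u≢w = either (∧-conicalʳ _ _ (trans (sym (at-v (combine p u) (combine q w))) (lifted-edge u≢w)))
        p≢q : ¬ p ≡ q
        p≢q p≡q = true≢false (trans (sym tp) (trans (cong T₀ p≡q) tq))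
        same : ∀ {i j} → (i == v) ≡ true → (j == v) ≡ true → i ≡ j
        same e e′ = trans (==-true e) (sym (==-true e′))
        no-common-end : (combine p zero == v) ≡ true ⊎ (combine q (suc zero) == v) ≡ true →
                        (combine p (suc (suc zero)) == v) ≡ true ⊎ (combine q zero == v) ≡ true → ⊥
        no-common-end (inj₁ e) (inj₁ e′) with FinP.combine-injectiveʳ p zero p (suc (suc zero)) (same e e′)
        ... | ()
        no-common-end (inj₁ e) (inj₂ e′) = p≢q (FinP.combine-injectiveˡ p zero q zero (same e e′))
        no-common-end (inj₂ e) (inj₁ e′) = p≢q (sym (FinP.combine-injectiveˡ q (suc zero) p (suc (suc zero)) (same e e′)))
        no-common-end (inj₂ e) (inj₂ e′) with FinP.combine-injectiveʳ q (suc zero) q zero (same e e′)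
        ... | ()

    not-superconnected : ¬ SuperEdgeConnected H
    not-superconnected (conn , minimum-trivial) with m≤n⇒m<n∨m≡n (z≤n {k})
    ... | inj₁ k>0 = not-vertex-cut k>0 (minimum-trivial (boundary H S₀) S₀-minimum)
    ... | inj₂ 0≡k = ∂≡0-separates H S₀ no-boundary a b sa sb (conn a b)
      where
      a b : Fin (suc m * n)
      a = proj₁ (proj₁ S₀-proper)
      b = proj₁ (proj₂ S₀-proper)
      sa : S₀ a ≡ true
      sa = proj₂ (proj₁ S₀-proper)
      sb : S₀ b ≡ false
      sb = proj₂ (proj₂ S₀-proper)
      no-boundary : ∂ H S₀ ≡ 0
      no-boundary = trans ∂S₀ (trans (cong (λ c → (n * n₁) * (2 * c)) (sym 0≡k)) (*-zeroʳ (n * n₁)))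

  -- If δ(G) < n κ'(G), then κ'(G) ≥ 1, G is connected
  -- and so is H.  A minimum cut of H is at most the star 2(n − 1) δ(G) of a
  -- vertex over a vertex of minimum degree; the lift of a cut of G is larger,
  -- so the minimum cut has a proper fibre and Tight applies.
  module Backward (F : EdgeSet G) (minF : IsMinEdgeCut G F) (not-K₂ : ¬ (Iso G (K 2) × n ≡ 3))
                  (large : δ G < n * size F) where
    k : ℕ
    k = size F

    k≥1 : 1 ≤ k
    k≥1 = n≢0⇒n>0 (λ k≡0 → n≮0 (subst (δ G <_) (trans (cong (n *_) k≡0) (*-zeroʳ n)) large))

    G-connected : Connected G
    G-connected = minCut-nonempty⇒connected G F minF k≥1

    degree≥1 : ∀ x → 1 ≤ degree G x
    degree≥1 with proj₁ minF
    ... | a , b , a↛b = connected⇒degree≥1 G G-connected a b (λ { refl → a↛b here })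

    boundary-positive : ∀ S → Proper S → 1 ≤ ∂ H S
    boundary-positive S proper with shape S proper
    ... | lifted T proper-T const =
      subst (1 ≤_) (sym (∂-lift S T const))
            (*-mono-≤ {1} {n * n₁} (s≤s z≤n) (≤-trans (≤-trans k≥1 (m≤m+n k _)) (minCut-≤-∂ G F minF T proper-T)))
    ... | split x₀ proper-x₀ =
      ≤-trans (*-mono-≤ {1} {2} (s≤s z≤n) (*-mono-≤ {1} {n₁} (s≤s z≤n) (degree≥1 x₀))) (split-bound S x₀ proper-x₀)

    -- H is connected: the vertices reachable from i form a bipartition with
    -- empty boundary, which cannot be proper.
    H-connected : Connected H
    H-connected i j with reach? (adj H) i j
    ... | inj₁ r = r
    ... | inj₂ i↛j = ⊥-elim (<-irrefl (sym (closed-∂≡0 H reachable closed))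
                                       (boundary-positive reachable ((i , source) , (j , unreachable j i↛j))))
      where open ReachableSet (adj H) i

    xδ : Fin (suc m)
    xδ = proj₁ (δ-attained G)

    star-proper : Proper (single xδ)
    star-proper = (combine xδ zero , ==-refl (combine xδ zero)) ,
                  (combine xδ (suc zero) , ==-false (λ e → zero≢one (FinP.combine-injectiveʳ xδ (suc zero) xδ zero e)))
      where
      zero≢one : ¬ Fin.suc {n₁} zero ≡ zero
      zero≢one ()

    ∂-star : ∂ H (single xδ) ≡ 2 * (n₁ * δ G)
    ∂-star = trans (∂-single xδ) (cong (λ d → 2 * (n₁ * d)) (sym (proj₂ (δ-attained G))))

    lifts-exceed-star : ∀ S T → Proper T → (∀ x u → A S x u ≡ T x) → 2 * (n₁ * δ G) < ∂ H S
    lifts-exceed-star S T proper-T const = begin-strict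
      2 * (n₁ * δ G)      <⟨ *-monoʳ-< 2 (*-monoʳ-< n₁ large) ⟩
      2 * (n₁ * (n * k))  ≡⟨ rearrange n n₁ k ⟩
      (n * n₁) * (2 * k)  ≤⟨ *-monoʳ-≤ (n * n₁) (minCut-≤-∂ G F minF T proper-T) ⟩
      (n * n₁) * ∂ G T    ≡⟨ ∂-lift S T const ⟨
      ∂ H S               ∎
      where
      open ≤-Reasoning
      rearrange : ∀ n n₁ k → 2 * (n₁ * (n * k)) ≡ (n * n₁) * (2 * k)
      rearrange = solve-∀

    -- A minimum cut of H is the boundary of some S no larger than the star,
    -- so S is not a lift and Tight applies to a proper fibre of S.
    minimum-cuts-trivial : ∀ F′ → IsMinEdgeCut H F′ → IsTrivialCut H F′
    minimum-cuts-trivial F′ minF′ = from-boundary (minCut-is-boundary H F′ minF′)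
      where
      from-boundary : Σ (Fin (suc m * n) → Bool) (λ S → Proper S × (∀ i j → mem F′ i j ≡ mem (boundary H S) i j)) →
                      IsTrivialCut H F′
      from-boundary (S , proper , F′≡∂S) = classify (shape S proper)
        where
        at-most-star : ∂ H S ≤ 2 * (n₁ * δ G)
        at-most-star = begin
          ∂ H S              ≡⟨ pairs-cong F′≡∂S ⟨
          pairs (mem F′)     ≡⟨ pairs-size F′ ⟩
          2 * size F′        ≤⟨ minCut-≤-∂ H F′ minF′ (single xδ) star-proper ⟩
          ∂ H (single xδ)    ≡⟨ ∂-star ⟩
          2 * (n₁ * δ G)     ∎
          where open ≤-Reasoning

        conclude : VertexLike S ⊎ (Iso G (K 2) × n₁ ≡ 2) → IsTrivialCut H F′
        conclude (inj₁ (v , like-v)) = vertex-like⇒trivial H F′ S v F′≡∂S like-v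
        conclude (inj₂ (iso , n₁≡2)) = ⊥-elim (not-K₂ (iso , cong suc n₁≡2))

        classify : Shape S → IsTrivialCut H F′
        classify (lifted T proper-T const) = ⊥-elim (<⇒≱ (lifts-exceed-star S T proper-T const) at-most-star)
        classify (split x₀ proper-x₀) = conclude (Tight.outcome G-connected degree≥1 S x₀ proper-x₀ at-most-star)

    superconnected : SuperEdgeConnected H
    superconnected = H-connected , minimum-cuts-trivial

-- With a single vertex in G, the product G × K_n has no edges, so it is
-- disconnected as soon as n ≥ 2.
one-vertex-product-disconnected : ∀ n₂ (G : Graph 1) → ¬ Connected (G ⊗ K (suc (suc n₂)))
one-vertex-product-disconnected n₂ G conn = no-walk (conn first second)
  where
  H : Graph (1 * suc (suc n₂))
  H = G ⊗ K (suc (suc n₂))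
  first second : Fin (1 * suc (suc n₂))
  first  = combine {1} {suc (suc n₂)} zero zero
  second = combine {1} {suc (suc n₂)} zero (suc zero)
  no-edges : ∀ i j → adj H i j ≡ false
  no-edges i j with proj₁ (remQuot {1} (suc (suc n₂)) i) | proj₁ (remQuot {1} (suc (suc n₂)) j)
  ... | zero | zero rewrite adjIrrefl G zero = refl
  no-walk : ¬ Reach (adj H) first second
  no-walk (step {y = y} e _) = true≢false (trans (sym e) (no-edges first y))

-- The theorem.  For the one-vertex graph (κ' = 0) both sides fail; otherwise
-- κ' is the size of a minimum cut F, and the two directions are Forward
-- (applied to a side T₀ of F) and Backward.
corollary2 : (n m : ℕ) → 3 ≤ n → (G : Graph (suc m)) →
             ¬ (Iso G (K 2) × n ≡ 3) →
             (k : ℕ) → EdgeConnectivity G k →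
             (SuperEdgeConnected (G ⊗ K n) ⇔ δ G < n * k)
corollary2 (suc (suc (suc n₃))) .0 (s≤s (s≤s (s≤s z≤n))) G _ .0 (inj₁ (refl , refl)) =
  mk⇔ (λ super → ⊥-elim (one-vertex-product-disconnected (suc n₃) G (proj₁ super)))
      (λ δ<0 → ⊥-elim (n≮0 (subst (δ G <_) (*-zeroʳ (suc (suc (suc n₃)))) δ<0)))
corollary2 (suc (suc (suc n₃))) m (s≤s (s≤s (s≤s z≤n))) G not-K₂ .(size F) (inj₂ (F , minF , refl)) =
  mk⇔ forward (Backward.superconnected F minF not-K₂)
  where
  open Product {m} {n₃} G
  forward : SuperEdgeConnected H → δ G < n * size F
  forward super with minCut-is-boundary G F minF
  ... | T₀ , proper , F≡∂T₀ = ≰⇒> (λ small → Forward.not-superconnected F minF T₀ proper F≡∂T₀ small super)
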